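{- Let $q=2^k t+1$ be a prime power, where $k>1$ is an integer and $t>1$ is an odd integer. Then there exist $\beta_1,\beta_2\in NQR(q)$ such that $\beta_1+1\in NQR(q)$, $\beta_2+1\in QR(q)$, $\beta_1-1\in NQR(q)$ and $\beta_2-1\in QR(q)$.
   Context: $QR(q)$ denotes the set of nonzero squares in $\mathbb{F}_q^*$ and $NQR(q)=\mathbb{F}_q^*\setminus QR(q)$ the set of non-squares. -}

module Defs where

open import Level using (_⊔_)
open import Data.Nat using (ℕ)
open import Data.Fin using (Fin)
open import Data.Product using (Σ; ∃; _×_)
open import Relation.Nullary using (¬_)
open import Algebra.Bundles using (CommutativeRing)
open import Function.Bundles using (Bijection)
import Relation.Binary.PropositionalEquality as ≡

record IsFiniteField {c ℓ} (R : CommutativeRing c ℓ) (q : ℕ) : Set (c ⊔ ℓ) where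
  open CommutativeRing R
  field
    one≉zero    : ¬ (1# ≈ 0#)
    invertible  : ∀ x → ¬ (x ≈ 0#) → ∃ λ y → x * y ≈ 1#
    cardinality : Bijection (≡.setoid (Fin q)) setoid

module _ {c ℓ} (R : CommutativeRing c ℓ) where
  open CommutativeRing R

  QR : Carrier → Set (c ⊔ ℓ)
  QR x = ¬ (x ≈ 0#) × ∃ λ y → y * y ≈ x

  NQR : Carrier → Set (c ⊔ ℓ)
  NQR x = ¬ (x ≈ 0#) × ¬ QR x

-- Write q = 4u + 1, where u = 2^(k-2) t ≥ 3, and let χ be the quadratic character.
-- As -1 is a square, χ(β⁻¹ ± 1) = χ(β ± 1) χ(β), so it suffices to find a nonsquare β
-- with β + 1 and β - 1 squares: take β₂ = β and β₁ = β⁻¹. Suppose there is none. For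
-- y = (x² + 1)/(2x) one has y² - 1 = ((x² - 1)/(2x))², which forces y to be a square,
-- i.e. χ(x) χ(x² + 1) = χ(2) whenever x (x² + 1) ≠ 0; hence the Jacobsthal sum
-- φ(1) = Σₓ χ(x) χ(x² + 1) equals χ(2)(q - 3). Since φ(t² a) = χ(t) φ(a), each of the
-- 2u nonzero squares a has φ(a)² = (q - 3)², while orthogonality of χ gives
-- Σₐ φ(a)² = 2q(q - 1). Thus 2u (q - 3)² ≤ 2q(q - 1), i.e. q ≤ 9, contradicting u ≥ 3.

module Submission where

open import Algebra.Bundles using (CommutativeRing)
open import Data.Nat.Base as ℕ using (ℕ; suc)
open import Relation.Binary.PropositionalEquality.Core using (_≡_)
open import Defs

module IntegerFacts where

  open import Data.Nat.Base as ℕ using (zero; suc; z≤n)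
  import Data.Nat.Properties as ℕₚ
  open import Data.Integer.Base using (ℤ; +_; -[1+_]; _+_; _-_; _*_; -_; _≤_; _<_; 0ℤ; 1ℤ; +≤+; +<+)
  import Data.Integer.Properties as ℤₚ
  open import Data.Integer.Tactic.RingSolver using (solve-∀)
  open import Data.Product.Base using (_×_; _,_)
  open import Relation.Binary.PropositionalEquality

  nonneg-+-≡0 : ∀ {a b} → 0ℤ ≤ a → 0ℤ ≤ b → a + b ≡ 0ℤ → a ≡ 0ℤ × b ≡ 0ℤ
  nonneg-+-≡0 {+ zero}  {+ zero}  _ _ _ = refl , refl
  nonneg-+-≡0 {+ zero}  {+ suc _} _ _ ()
  nonneg-+-≡0 {+ suc _} {+ _}     _ _ ()

  nonneg-* : ∀ {i j} → 0ℤ ≤ i → 0ℤ ≤ j → 0ℤ ≤ i * j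
  nonneg-* {+ m} {+ n} _ _ = subst (0ℤ ≤_) (ℤₚ.pos-* m n) (+≤+ z≤n)

  square-nonneg : ∀ i → 0ℤ ≤ i * i
  square-nonneg (+ n)    = nonneg-* {+ n} {+ n} (+≤+ z≤n) (+≤+ z≤n)
  square-nonneg -[1+ n ] = +≤+ z≤n

  self≡neg⇒0 : ∀ a → a ≡ - a → a ≡ 0ℤ
  self≡neg⇒0 (+ 0)     _  = refl
  self≡neg⇒0 (+ suc _) ()
  self≡neg⇒0 -[1+ _ ]  ()

  2*≢1 : ∀ z → + 2 * z ≢ 1ℤ
  2*≢1 (+ 0)     ()
  2*≢1 (+ suc n) eq = ℕₚ.m+1+n≢0 n (ℕₚ.suc-injective (ℤₚ.+-injective eq))
  2*≢1 -[1+ n ]  ()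

  even≢odd : ∀ a b → + 2 * a ≢ 1ℤ + + 2 * b
  even≢odd a b eq = 2*≢1 (a - b) (begin
    + 2 * (a - b)           ≡⟨ expand a b ⟩
    + 2 * a - + 2 * b       ≡⟨ cong (_- + 2 * b) eq ⟩
    1ℤ + + 2 * b - + 2 * b  ≡⟨ cancel b ⟩
    1ℤ                      ∎)
    where
    open ≡-Reasoning
    expand : ∀ a b → + 2 * (a - b) ≡ + 2 * a - + 2 * b
    expand = solve-∀
    cancel : ∀ b → 1ℤ + + 2 * b - + 2 * b ≡ 1ℤ
    cancel = solve-∀

  2q[q-1]<2n[q-3]² : ∀ {n} → 3 ℕ.≤ n → let q = 1ℤ + + 4 * + n in + 2 * q * (q - 1ℤ) < + 2 * + n * ((q - + 3) * (q - + 3))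
  2q[q-1]<2n[q-3]² {n@(suc (suc (suc _)))} (ℕ.s≤s (ℕ.s≤s (ℕ.s≤s _))) =
    subst₂ _<_ (ℤₚ.+-identityʳ _) (sym (excess (+ n))) (ℤₚ.+-monoʳ-< (+ 2 * q * (q - 1ℤ)) (+<+ (ℕ.s≤s ℕ.z≤n)))
    where
    q : ℤ
    q = 1ℤ + + 4 * + n
    excess : ∀ n → let q = 1ℤ + + 4 * n in
             + 2 * n * ((q - + 3) * (q - + 3)) ≡ + 2 * q * (q - 1ℤ) + + 32 * (n * n) * (n - + 2)
    excess = solve-∀

module IntegerSums where

  open import Data.Nat.Base using (zero; suc)
  open import Data.Fin.Base using (Fin) renaming (zero to fzero; suc to fsuc)
  open import Data.Fin.Properties using (suc-injective)
  open import Data.Integer.Base using (ℤ; +_; _+_; _*_; -_; _≤_; 0ℤ)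
  import Data.Integer.Properties as ℤₚ
  open import Data.Product.Base using (proj₁; proj₂)
  open import Function.Base using (_∘_)
  open import Relation.Binary.PropositionalEquality
  open IntegerFacts using (nonneg-+-≡0)
  open import Algebra.Properties.Semiring.Sum ℤₚ.+-*-semiring public
    using (sum; sum-cong-≗; sum-permute; ∑-distrib-+; ∑-comm; *-distribˡ-sum)

  sum-neg : ∀ {n} (f : Fin n → ℤ) → sum (-_ ∘ f) ≡ - sum f
  sum-neg {zero}  f = refl
  sum-neg {suc n} f = trans (cong (λ s → - f fzero + s) (sum-neg (f ∘ fsuc))) (sym (ℤₚ.neg-distrib-+ (f fzero) _))

  sum-const : ∀ n (c : ℤ) → sum {n} (λ _ → c) ≡ + n * c
  sum-const zero    c = sym (ℤₚ.*-zeroˡ c)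
  sum-const (suc n) c = begin
    c + sum {n} (λ _ → c)  ≡⟨ cong (λ s → c + s) (sum-const n c) ⟩
    c + + n * c            ≡⟨ cong (_+ + n * c) (sym (ℤₚ.*-identityˡ c)) ⟩
    + 1 * c + + n * c      ≡⟨ sym (ℤₚ.*-distribʳ-+ c (+ 1) (+ n)) ⟩
    + suc n * c            ∎
    where open ≡-Reasoning

  sum-zero : ∀ {n} (f : Fin n → ℤ) → (∀ i → f i ≡ 0ℤ) → sum f ≡ 0ℤ
  sum-zero {zero}  f f≡0 = refl
  sum-zero {suc n} f f≡0 = cong₂ _+_ (f≡0 fzero) (sum-zero (f ∘ fsuc) (f≡0 ∘ fsuc))

  sum-single : ∀ {n} (f : Fin n → ℤ) i → (∀ j → j ≢ i → f j ≡ 0ℤ) → sum f ≡ f i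
  sum-single {suc n} f fzero    f≡0 =
    trans (cong (λ s → f fzero + s) (sum-zero (f ∘ fsuc) (λ j → f≡0 (fsuc j) λ ()))) (ℤₚ.+-identityʳ _)
  sum-single {suc n} f (fsuc i) f≡0 =
    trans (cong₂ _+_ (f≡0 fzero λ ()) (sum-single (f ∘ fsuc) i (λ j j≢i → f≡0 (fsuc j) (j≢i ∘ suc-injective))))
          (ℤₚ.+-identityˡ _)

  sum-mono-≤ : ∀ {n} {f g : Fin n → ℤ} → (∀ i → f i ≤ g i) → sum f ≤ sum g
  sum-mono-≤ {zero}  f≤g = ℤₚ.≤-refl
  sum-mono-≤ {suc n} f≤g = ℤₚ.+-mono-≤ (f≤g fzero) (sum-mono-≤ (f≤g ∘ fsuc))

  sum-nonneg : ∀ {n} {f : Fin n → ℤ} → (∀ i → 0ℤ ≤ f i) → 0ℤ ≤ sum f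
  sum-nonneg {n} {f} 0≤f = subst (_≤ sum f) (sum-zero {n} (λ _ → 0ℤ) (λ _ → refl)) (sum-mono-≤ 0≤f)

  sum-nonneg-≡0 : ∀ {n} {f : Fin n → ℤ} → (∀ i → 0ℤ ≤ f i) → sum f ≡ 0ℤ → ∀ i → f i ≡ 0ℤ
  sum-nonneg-≡0 {suc n} 0≤f Σ≡0 fzero    = proj₁ (nonneg-+-≡0 (0≤f fzero) (sum-nonneg (0≤f ∘ fsuc)) Σ≡0)
  sum-nonneg-≡0 {suc n} 0≤f Σ≡0 (fsuc i) =
    sum-nonneg-≡0 (0≤f ∘ fsuc) (proj₂ (nonneg-+-≡0 (0≤f fzero) (sum-nonneg (0≤f ∘ fsuc)) Σ≡0)) i

module IntegerCoefficients {c ℓ} (R : CommutativeRing c ℓ) where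

  open import Data.Nat.Base using (zero; suc)
  import Data.Nat.Properties as ℕₚ
  open import Data.Integer.Base as ℤ using (ℤ; +_; -[1+_]; sign; ∣_∣; _◃_) renaming (_⊖_ to _⊖ℕ_)
  import Data.Integer.Properties as ℤₚ
  open import Data.Sign.Base as Sign using (Sign)
  open import Data.Maybe.Base using (Maybe; just; nothing)
  open import Relation.Nullary.Decidable.Core using (yes; no)
  import Relation.Binary.PropositionalEquality as ≡
  import Algebra.Solver.Ring
  open import Algebra.Solver.Ring.AlmostCommutativeRing
    using (fromCommutativeRing; _-Raw-AlmostCommutative⟶_)

  open CommutativeRing R
  open import Algebra.Properties.Ring ring using (-‿distribˡ-*; -‿involutive; -0#≈0#; -‿+-comm)
  open import Algebra.Properties.Semiring.Mult.TCOptimised semiring using (_×_; 1+×; ×-homo-+; ×1-homo-*)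
  open import Relation.Binary.Reasoning.Setoid setoid

  -- The optimised _×_ makes ⟦ + 1 ⟧ℤ definitionally 1#, so that the solver's constant
  -- con (+ 1) matches 1# in goals.
  ⟦_⟧ℤ : ℤ → Carrier
  ⟦ + n      ⟧ℤ = n × 1#
  ⟦ -[1+ n ] ⟧ℤ = - (suc n × 1#)

  private
    sgn : Sign → Carrier
    sgn Sign.+ = 1#
    sgn Sign.- = - 1#

    sgn-* : ∀ s t → sgn (s Sign.* t) ≈ sgn s * sgn t
    sgn-* Sign.+ Sign.+ = sym (*-identityˡ _)
    sgn-* Sign.+ Sign.- = sym (*-identityˡ _)
    sgn-* Sign.- Sign.+ = sym (*-identityʳ _)
    sgn-* Sign.- Sign.- = begin
      1#              ≈⟨ -‿involutive 1# ⟨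
      - - 1#          ≈⟨ -‿cong (*-identityˡ (- 1#)) ⟨
      - (1# * - 1#)   ≈⟨ -‿distribˡ-* 1# (- 1#) ⟩
      - 1# * - 1#     ∎

    ⟦◃⟧ : ∀ s n → ⟦ s ◃ n ⟧ℤ ≈ sgn s * (n × 1#)
    ⟦◃⟧ s       zero    = sym (zeroʳ _)
    ⟦◃⟧ Sign.+ (suc n) = sym (*-identityˡ _)
    ⟦◃⟧ Sign.- (suc n) = trans (-‿cong (sym (*-identityˡ _))) (-‿distribˡ-* 1# _)

    ⟦⟧-sign : ∀ i → ⟦ i ⟧ℤ ≈ sgn (sign i) * (∣ i ∣ × 1#)
    ⟦⟧-sign (+ n)    = sym (*-identityˡ _)
    ⟦⟧-sign -[1+ n ] = ⟦◃⟧ Sign.- (suc n)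

    ⟦⊖⟧ : ∀ m n → ⟦ m ⊖ℕ n ⟧ℤ ≈ m × 1# - n × 1#
    ⟦⊖⟧ m       zero    = sym (trans (+-congˡ -0#≈0#) (+-identityʳ _))
    ⟦⊖⟧ zero    (suc n) = sym (+-identityˡ _)
    ⟦⊖⟧ (suc m) (suc n) = begin
      ⟦ suc m ⊖ℕ suc n ⟧ℤ                ≡⟨ ≡.cong ⟦_⟧ℤ (ℤₚ.[1+m]⊖[1+n]≡m⊖n m n) ⟩
      ⟦ m ⊖ℕ n ⟧ℤ                         ≈⟨ ⟦⊖⟧ m n ⟩
      m × 1# - n × 1#                     ≈⟨ cancel-1 (m × 1#) (n × 1#) ⟨
      (1# + m × 1#) - (1# + n × 1#)       ≈⟨ +-cong (1+× m 1#) (-‿cong (1+× n 1#)) ⟨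
      suc m × 1# - suc n × 1#             ∎
      where
      cancel-1 : ∀ a b → (1# + a) - (1# + b) ≈ a - b
      cancel-1 a b = begin
        (1# + a) - (1# + b)
          ≈⟨ +-congˡ (-‿+-comm 1# b) ⟨
        (1# + a) + (- 1# + - b)
          ≈⟨ +-assoc _ _ _ ⟩
        1# + (a + (- 1# + - b))
          ≈⟨ +-congˡ (trans (sym (+-assoc _ _ _)) (trans (+-congʳ (+-comm _ _)) (+-assoc _ _ _))) ⟩
        1# + (- 1# + (a - b))
          ≈⟨ sym (+-assoc _ _ _) ⟩
        (1# - 1#) + (a - b)
          ≈⟨ +-congʳ (-‿inverseʳ 1#) ⟩
        0# + (a - b)
          ≈⟨ +-identityˡ _ ⟩
        a - b ∎

  ⟦⟧-homo-+ : ∀ i j → ⟦ i ℤ.+ j ⟧ℤ ≈ ⟦ i ⟧ℤ + ⟦ j ⟧ℤ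
  ⟦⟧-homo-+ -[1+ m ] -[1+ n ] = begin
    - (suc (suc (m ℕ.+ n)) × 1#)        ≡⟨ ≡.cong (λ k → - (suc k × 1#)) (≡.sym (ℕₚ.+-suc m n)) ⟩
    - ((suc m ℕ.+ suc n) × 1#)          ≈⟨ -‿cong (×-homo-+ 1# (suc m) (suc n)) ⟩
    - (suc m × 1# + suc n × 1#)         ≈⟨ -‿+-comm _ _ ⟨
    - (suc m × 1#) + - (suc n × 1#)     ∎
  ⟦⟧-homo-+ -[1+ m ] (+ n)    = trans (⟦⊖⟧ n (suc m)) (+-comm _ _)
  ⟦⟧-homo-+ (+ m)    -[1+ n ] = ⟦⊖⟧ m (suc n)
  ⟦⟧-homo-+ (+ m)    (+ n)    = ×-homo-+ 1# m n

  ⟦⟧-homo-* : ∀ i j → ⟦ i ℤ.* j ⟧ℤ ≈ ⟦ i ⟧ℤ * ⟦ j ⟧ℤ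
  ⟦⟧-homo-* i j = begin
    ⟦ sign i Sign.* sign j ◃ ∣ i ∣ ℕ.* ∣ j ∣ ⟧ℤ
      ≈⟨ ⟦◃⟧ (sign i Sign.* sign j) (∣ i ∣ ℕ.* ∣ j ∣) ⟩
    sgn (sign i Sign.* sign j) * ((∣ i ∣ ℕ.* ∣ j ∣) × 1#)
      ≈⟨ *-cong (sgn-* (sign i) (sign j)) (×1-homo-* ∣ i ∣ ∣ j ∣) ⟩
    (sgn (sign i) * sgn (sign j)) * (∣ i ∣ × 1# * ∣ j ∣ × 1#)
      ≈⟨ interchange _ _ _ _ ⟩
    (sgn (sign i) * ∣ i ∣ × 1#) * (sgn (sign j) * ∣ j ∣ × 1#)
      ≈⟨ *-cong (⟦⟧-sign i) (⟦⟧-sign j) ⟨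
    ⟦ i ⟧ℤ * ⟦ j ⟧ℤ ∎
    where open import Algebra.Properties.CommutativeSemigroup *-commutativeSemigroup using (interchange)

  ⟦⟧-homo-neg : ∀ i → ⟦ ℤ.- i ⟧ℤ ≈ - ⟦ i ⟧ℤ
  ⟦⟧-homo-neg (+ zero)  = sym -0#≈0#
  ⟦⟧-homo-neg (+ suc n) = refl
  ⟦⟧-homo-neg -[1+ n ]  = sym (-‿involutive _)

  ℤ⟶R : ℤ.+-*-rawRing -Raw-AlmostCommutative⟶ fromCommutativeRing R
  ℤ⟶R = record
    { ⟦_⟧    = ⟦_⟧ℤ
    ; +-homo = ⟦⟧-homo-+
    ; *-homo = ⟦⟧-homo-*
    ; -‿homo = ⟦⟧-homo-neg
    ; 0-homo = refl
    ; 1-homo = refl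
    }

  private
    coefficients≟ : ∀ i j → Maybe (⟦ i ⟧ℤ ≈ ⟦ j ⟧ℤ)
    coefficients≟ i j with i ℤₚ.≟ j
    ... | yes ≡.refl = just refl
    ... | no _       = nothing

  open Algebra.Solver.Ring ℤ.+-*-rawRing (fromCommutativeRing R) ℤ⟶R coefficients≟ public
    using (solve; _:=_; _:+_; _:*_; :-_; _:-_; con)

module Indicator where

  open import Data.Bool.Base using (if_then_else_)
  open import Data.Empty using (⊥-elim)
  open import Data.Integer.Base as ℤ using (ℤ; 0ℤ; 1ℤ; +≤+)
  open import Data.Nat.Base using (z≤n)
  open import Relation.Binary.PropositionalEquality using (refl)
  open import Relation.Nullary.Decidable using (Dec; yes; no; does)
  open import Relation.Nullary.Negation using (¬_)

  ind : ∀ {a} {A : Set a} → Dec A → ℤ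
  ind d = if does d then 1ℤ else 0ℤ

  ind-yes : ∀ {a} {A : Set a} → A → (d : Dec A) → ind d ≡ 1ℤ
  ind-yes a (yes _) = refl
  ind-yes a (no ¬a) = ⊥-elim (¬a a)

  ind-no : ∀ {a} {A : Set a} → ¬ A → (d : Dec A) → ind d ≡ 0ℤ
  ind-no ¬a (yes a) = ⊥-elim (¬a a)
  ind-no ¬a (no _)  = refl

  ind-cong : ∀ {a b} {A : Set a} {B : Set b} (a? : Dec A) (b? : Dec B) → (A → B) → (B → A) → ind a? ≡ ind b?
  ind-cong (yes _) (yes _) _   _   = refl
  ind-cong (yes a) (no ¬b) A⇒B _   = ⊥-elim (¬b (A⇒B a))
  ind-cong (no ¬a) (yes b) _   B⇒A = ⊥-elim (¬a (B⇒A b))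
  ind-cong (no _)  (no _)  _   _   = refl

  ind-nonneg : ∀ {a} {A : Set a} (d : Dec A) → 0ℤ ℤ.≤ ind d
  ind-nonneg (yes _) = +≤+ z≤n
  ind-nonneg (no _)  = +≤+ z≤n

  ind-exclusive : ∀ {a b} {A : Set a} {B : Set b} (a? : Dec A) (b? : Dec B) →
                  (A → ¬ B) → (¬ A → ¬ ¬ B) → ind b? ≡ 1ℤ ℤ.- ind a?
  ind-exclusive (yes a) (yes b) A⇒¬B _    = ⊥-elim (A⇒¬B a b)
  ind-exclusive (yes _) (no _)  _    _    = refl
  ind-exclusive (no _)  (yes _) _    _    = refl
  ind-exclusive (no ¬a) (no ¬b) _    ¬A⇒B = ⊥-elim (¬A⇒B ¬a ¬b)

module FiniteField {c ℓ} (F : CommutativeRing c ℓ) {q : ℕ} (isFF : IsFiniteField F q) where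

  open import Data.Empty using (⊥-elim)
  open import Data.Fin.Base using (Fin)
  open import Data.Fin.Properties as Finₚ using ()
  open import Data.Integer.Base using (+_)
  open import Data.Product.Base using (∃; _,_; proj₁; proj₂)
  open import Data.Sum.Base using (_⊎_; inj₁; inj₂)
  open import Function.Base using (_∘_)
  open import Function.Bundles using (Bijection)
  import Relation.Binary.PropositionalEquality as ≡
  open import Relation.Nullary.Decidable using (Dec; yes; no; map′)
  open import Relation.Nullary.Negation using (¬_)

  open IntegerCoefficients F using (solve; _:=_; _:+_; _:*_; :-_; _:-_; con)

  open CommutativeRing F
  open IsFiniteField isFF public using (one≉zero)
  open IsFiniteField isFF using (invertible; cardinality)
  open Bijection cardinality public using () renaming (to to el; injective to el-injective; surjective to el-surjective)
  import Relation.Binary.Reasoning.Setoid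
  module ≈-Reasoning = Relation.Binary.Reasoning.Setoid setoid

  2# : Carrier
  2# = 1# + 1#

  index : Carrier → Fin q
  index x = proj₁ (el-surjective x)

  el-index : ∀ x → el (index x) ≈ x
  el-index x = proj₂ (el-surjective x) ≡.refl

  index-cong : ∀ {x y} → x ≈ y → index x ≡ index y
  index-cong {x} {y} x≈y = el-injective (trans (el-index x) (trans x≈y (sym (el-index y))))

  index-el : ∀ i → index (el i) ≡ i
  index-el i = el-injective (el-index (el i))

  infix 4 _≈?_
  opaque
    _≈?_ : ∀ x y → Dec (x ≈ y)
    x ≈? y = map′ (λ i≡j → trans (sym (el-index x)) (trans (reflexive (≡.cong el i≡j)) (el-index y)))
                  index-cong (index x Finₚ.≟ index y)

  ∃? : ∀ {p} {P : Carrier → Set p} → (∀ x → Dec (P x)) → (∀ {x y} → x ≈ y → P x → P y) → Dec (∃ P)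
  ∃? P? resp = map′ (λ (i , p) → el i , p) (λ (x , p) → index x , resp (sym (el-index x)) p)
                    (Finₚ.any? (P? ∘ el))

  -- Junk value: 0⁻¹ = 0.
  opaque
    _⁻¹ : Carrier → Carrier
    x ⁻¹ with x ≈? 0#
    ... | yes _   = 0#
    ... | no x≉0  = proj₁ (invertible x x≉0)

    ⁻¹-inverseʳ : ∀ {x} → ¬ (x ≈ 0#) → x * x ⁻¹ ≈ 1#
    ⁻¹-inverseʳ {x} x≉0 with x ≈? 0#
    ... | yes x≈0 = ⊥-elim (x≉0 x≈0)
    ... | no x≉0′ = proj₂ (invertible x x≉0′)

    0⁻¹≈0 : ∀ {x} → x ≈ 0# → x ⁻¹ ≈ 0#
    0⁻¹≈0 {x} x≈0 with x ≈? 0#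
    ... | yes _   = refl
    ... | no x≉0  = ⊥-elim (x≉0 x≈0)

  ⁻¹-inverseˡ : ∀ {x} → ¬ (x ≈ 0#) → x ⁻¹ * x ≈ 1#
  ⁻¹-inverseˡ x≉0 = trans (*-comm _ _) (⁻¹-inverseʳ x≉0)

  *-cancelˡ : ∀ {x y z} → ¬ (x ≈ 0#) → x * y ≈ x * z → y ≈ z
  *-cancelˡ {x} {y} {z} x≉0 xy≈xz = begin
    y                 ≈⟨ *-identityˡ y ⟨
    1# * y            ≈⟨ *-congʳ (⁻¹-inverseˡ x≉0) ⟨
    (x ⁻¹ * x) * y    ≈⟨ *-assoc _ _ _ ⟩
    x ⁻¹ * (x * y)    ≈⟨ *-congˡ xy≈xz ⟩
    x ⁻¹ * (x * z)    ≈⟨ *-assoc _ _ _ ⟨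
    (x ⁻¹ * x) * z    ≈⟨ *-congʳ (⁻¹-inverseˡ x≉0) ⟩
    1# * z            ≈⟨ *-identityˡ z ⟩
    z                 ∎
    where open ≈-Reasoning

  *≈0⇒ : ∀ {x y} → x * y ≈ 0# → x ≈ 0# ⊎ y ≈ 0#
  *≈0⇒ {x} {y} xy≈0 with x ≈? 0#
  ... | yes x≈0 = inj₁ x≈0
  ... | no x≉0  = inj₂ (*-cancelˡ x≉0 (trans xy≈0 (sym (zeroʳ x))))

  *-≉0 : ∀ {x y} → ¬ (x ≈ 0#) → ¬ (y ≈ 0#) → ¬ (x * y ≈ 0#)
  *-≉0 x≉0 y≉0 xy≈0 with *≈0⇒ xy≈0
  ... | inj₁ x≈0 = x≉0 x≈0
  ... | inj₂ y≈0 = y≉0 y≈0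

  x*x≈0⇒x≈0 : ∀ {x} → x * x ≈ 0# → x ≈ 0#
  x*x≈0⇒x≈0 xx≈0 with *≈0⇒ xx≈0
  ... | inj₁ x≈0 = x≈0
  ... | inj₂ x≈0 = x≈0

  ⁻¹-≉0 : ∀ {x} → ¬ (x ≈ 0#) → ¬ (x ⁻¹ ≈ 0#)
  ⁻¹-≉0 {x} x≉0 x⁻¹≈0 = one≉zero (trans (sym (⁻¹-inverseʳ x≉0)) (trans (*-congˡ x⁻¹≈0) (zeroʳ x)))

  ⁻¹-cong : ∀ {x y} → x ≈ y → x ⁻¹ ≈ y ⁻¹
  ⁻¹-cong {x} {y} x≈y = by-cases (x ≈? 0#)
    where
    by-cases : Dec (x ≈ 0#) → x ⁻¹ ≈ y ⁻¹
    by-cases (yes x≈0) = trans (0⁻¹≈0 x≈0) (sym (0⁻¹≈0 (trans (sym x≈y) x≈0)))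
    by-cases (no x≉0)  = *-cancelˡ x≉0 (begin
      x * x ⁻¹   ≈⟨ ⁻¹-inverseʳ x≉0 ⟩
      1#         ≈⟨ ⁻¹-inverseʳ (x≉0 ∘ trans x≈y) ⟨
      y * y ⁻¹   ≈⟨ *-congʳ x≈y ⟨
      x * y ⁻¹   ∎)
      where open ≈-Reasoning

  ⁻¹-involutive : ∀ x → x ⁻¹ ⁻¹ ≈ x
  ⁻¹-involutive x = by-cases (x ≈? 0#)
    where
    by-cases : Dec (x ≈ 0#) → x ⁻¹ ⁻¹ ≈ x
    by-cases (yes x≈0) = trans (0⁻¹≈0 (0⁻¹≈0 x≈0)) (sym x≈0)
    by-cases (no x≉0)  = *-cancelˡ (⁻¹-≉0 x≉0) (trans (⁻¹-inverseʳ (⁻¹-≉0 x≉0)) (sym (⁻¹-inverseˡ x≉0)))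

  1⁻¹≈1 : 1# ⁻¹ ≈ 1#
  1⁻¹≈1 = *-cancelˡ one≉zero (trans (⁻¹-inverseʳ one≉zero) (sym (*-identityˡ 1#)))

  ⁻¹≈1⇒≈1 : ∀ {x} → x ⁻¹ ≈ 1# → x ≈ 1#
  ⁻¹≈1⇒≈1 {x} x⁻¹≈1 = trans (sym (⁻¹-involutive x)) (trans (⁻¹-cong x⁻¹≈1) 1⁻¹≈1)

  -1≉0 : ¬ (- 1# ≈ 0#)
  -1≉0 -1≈0 = one≉zero (trans (sym (-‿involutive 1#)) (trans (-‿cong -1≈0) -0#≈0#))
    where open import Algebra.Properties.Ring ring using (-‿involutive; -0#≈0#)

  x*x≈y*y⇒ : ∀ {x y} → x * x ≈ y * y → y ≈ x ⊎ y ≈ - x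
  x*x≈y*y⇒ {x} {y} xx≈yy with *≈0⇒ (begin
      (x - y) * (x + y)  ≈⟨ solve 2 (λ x y → (x :- y) :* (x :+ y) := x :* x :- y :* y) refl x y ⟩
      x * x - y * y      ≈⟨ +-congʳ xx≈yy ⟩
      y * y - y * y      ≈⟨ -‿inverseʳ _ ⟩
      0#                 ∎)
    where open ≈-Reasoning
  ... | inj₁ x-y≈0 = inj₁ (begin
      y              ≈⟨ solve 2 (λ x y → y := x :- (x :- y)) refl x y ⟩
      x - (x - y)    ≈⟨ +-congˡ (-‿cong x-y≈0) ⟩
      x - 0#         ≈⟨ solve 1 (λ x → x :- con (+ 0) := x) refl x ⟩
      x              ∎)
    where open ≈-Reasoning
  ... | inj₂ x+y≈0 = inj₂ (begin
      y              ≈⟨ solve 2 (λ x y → y := (x :+ y) :- x) refl x y ⟩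
      (x + y) - x    ≈⟨ +-congʳ x+y≈0 ⟩
      0# - x         ≈⟨ +-identityˡ _ ⟩
      - x            ∎)
    where open ≈-Reasoning

module FieldSums {c ℓ} (F : CommutativeRing c ℓ) {q : ℕ} (isFF : IsFiniteField F q) where

  open import Level using (_⊔_)
  open import Data.Fin.Base as Fin using (Fin)
  open import Data.Fin.Properties as Finₚ using (<-cmp; <-asym)
  open import Data.Fin.Permutation using (permutation)
  open import Data.Integer.Base as ℤ using (ℤ; +_; 0ℤ; 1ℤ)
  import Data.Integer.Properties as ℤₚ
  open import Data.Integer.Tactic.RingSolver using (solve-∀)
  open import Data.Product.Base using (∃-syntax; _,_)
  open import Function.Base using (_∘_)
  open import Relation.Binary.Definitions using (tri<; tri≈; tri>)
  import Relation.Binary.PropositionalEquality as ≡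
  open ≡ using (_≢_)
  open import Relation.Nullary.Decidable using (yes; no)
  open import Relation.Nullary.Negation using (¬_)

  open IntegerFacts using (self≡neg⇒0)
  open IntegerSums
  open Indicator
  open IntegerCoefficients F using (solve; _:=_; _:+_; _:-_)

  open CommutativeRing F
  open FiniteField F isFF

  Respects : (Carrier → ℤ) → Set (c ⊔ ℓ)
  Respects f = ∀ {x y} → x ≈ y → f x ≡ f y

  Σ : (Carrier → ℤ) → ℤ
  Σ f = sum (f ∘ el)

  Σ-cong : ∀ {f g} → (∀ x → f x ≡ g x) → Σ f ≡ Σ g
  Σ-cong f≡g = sum-cong-≗ (f≡g ∘ el)

  Σ-+ : ∀ f g → Σ (λ x → f x ℤ.+ g x) ≡ Σ f ℤ.+ Σ g
  Σ-+ f g = ∑-distrib-+ (f ∘ el) (g ∘ el)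

  Σ-neg : ∀ f → Σ (λ x → ℤ.- f x) ≡ ℤ.- Σ f
  Σ-neg f = sum-neg (f ∘ el)

  Σ-*ˡ : ∀ k f → Σ (λ x → k ℤ.* f x) ≡ k ℤ.* Σ f
  Σ-*ˡ k f = ≡.sym (*-distribˡ-sum k (f ∘ el))

  Σ-const : ∀ k → Σ (λ _ → k) ≡ + q ℤ.* k
  Σ-const k = sum-const q k

  Σ-comm : ∀ (f : Carrier → Carrier → ℤ) → Σ (λ x → Σ (f x)) ≡ Σ (λ y → Σ (λ x → f x y))
  Σ-comm f = ∑-comm (λ i j → f (el i) (el j))

  Σ-zero : ∀ {f} → (∀ x → f x ≡ 0ℤ) → Σ f ≡ 0ℤ
  Σ-zero f≡0 = sum-zero _ (f≡0 ∘ el)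

  Σ-single : ∀ f → Respects f → ∀ a → (∀ x → ¬ (x ≈ a) → f x ≡ 0ℤ) → Σ f ≡ f a
  Σ-single f f-resp a f≡0 =
    ≡.trans (sum-single (f ∘ el) (index a) (λ j j≢a → f≡0 (el j) (j≢a ∘ ≡.trans (≡.sym (index-el j)) ∘ index-cong)))
            (f-resp (el-index a))

  Σ-mono-≤ : ∀ {f g} → (∀ x → f x ℤ.≤ g x) → Σ f ℤ.≤ Σ g
  Σ-mono-≤ f≤g = sum-mono-≤ (f≤g ∘ el)

  Σ-nonneg-≡0 : ∀ {f} → Respects f → (∀ x → 0ℤ ℤ.≤ f x) → Σ f ≡ 0ℤ → ∀ x → f x ≡ 0ℤ
  Σ-nonneg-≡0 f-resp 0≤f Σ≡0 x = ≡.trans (f-resp (sym (el-index x))) (sum-nonneg-≡0 (0≤f ∘ el) Σ≡0 (index x))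

  Σ-reindex : ∀ (σ τ : Carrier → Carrier) → (∀ {x y} → x ≈ y → σ x ≈ σ y) → (∀ {x y} → x ≈ y → τ x ≈ τ y) →
              (∀ x → σ (τ x) ≈ x) → (∀ x → τ (σ x) ≈ x) → ∀ f → Respects f → Σ (f ∘ σ) ≡ Σ f
  Σ-reindex σ τ σ-cong τ-cong στ τσ f f-resp =
    ≡.trans (sum-cong-≗ (λ i → f-resp (sym (el-index (σ (el i))))))
            (≡.sym (sum-permute (f ∘ el) π))
    where
    π = permutation (index ∘ σ ∘ el) (index ∘ τ ∘ el)
          (λ i → ≡.trans (index-cong (σ-cong (el-index _))) (≡.trans (index-cong (στ (el i))) (index-el i)))
          (λ i → ≡.trans (index-cong (τ-cong (el-index _))) (≡.trans (index-cong (τσ (el i))) (index-el i)))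

  private
    <-flip : ∀ {i j : Fin q} → i ≢ j → ind (j Finₚ.<? i) ≡ 1ℤ ℤ.- ind (i Finₚ.<? j)
    <-flip {i} {j} i≢j = ind-exclusive (i Finₚ.<? j) (j Finₚ.<? i) <-asym ¬<⇒>
      where
      ¬<⇒> : ¬ (i Fin.< j) → ¬ ¬ (j Fin.< i)
      ¬<⇒> i≮j j≮i with <-cmp i j
      ... | tri< i<j _ _ = i≮j i<j
      ... | tri≈ _ i≡j _ = i≢j i≡j
      ... | tri> _ _ j<i = j≮i j<i

  -- Orient each orbit {x, σ x} by comparing indices: the signed sum Σ ±p cancels,
  -- and p differs from ±p by an even amount.
  involution-sum-even : ∀ (σ : Carrier → Carrier) → (∀ {x y} → x ≈ y → σ x ≈ σ y) → (∀ x → σ (σ x) ≈ x) →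
                        ∀ p → Respects p → (∀ x → p (σ x) ≡ p x) → (∀ x → σ x ≈ x → p x ≡ 0ℤ) →
                        ∃[ m ] Σ p ≡ + 2 ℤ.* m
  involution-sum-even σ σ-cong σσ p p-resp pσ p-fix = Σ (λ x → before x ℤ.* p x) , (begin
    Σ p
      ≡⟨ Σ-cong (λ x → split (before x) (p x)) ⟩
    Σ (λ x → signed x ℤ.+ + 2 ℤ.* (before x ℤ.* p x))
      ≡⟨ Σ-+ signed (λ x → + 2 ℤ.* (before x ℤ.* p x)) ⟩
    Σ signed ℤ.+ Σ (λ x → + 2 ℤ.* (before x ℤ.* p x))
      ≡⟨ ≡.cong₂ ℤ._+_ Σsigned≡0 (Σ-*ˡ (+ 2) (λ x → before x ℤ.* p x)) ⟩
    0ℤ ℤ.+ + 2 ℤ.* Σ (λ x → before x ℤ.* p x)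
      ≡⟨ ℤₚ.+-identityˡ _ ⟩
    + 2 ℤ.* Σ (λ x → before x ℤ.* p x) ∎)
    where
    open ≡.≡-Reasoning
    before : Carrier → ℤ
    before x = ind (index (σ x) Finₚ.<? index x)

    signed : Carrier → ℤ
    signed x = (1ℤ ℤ.- + 2 ℤ.* before x) ℤ.* p x

    split : ∀ b v → v ≡ (1ℤ ℤ.- + 2 ℤ.* b) ℤ.* v ℤ.+ + 2 ℤ.* (b ℤ.* v)
    split = solve-∀

    flip : ∀ b v → (1ℤ ℤ.- + 2 ℤ.* (1ℤ ℤ.- b)) ℤ.* v ≡ ℤ.- ((1ℤ ℤ.- + 2 ℤ.* b) ℤ.* v)
    flip = solve-∀

    vanish : ∀ b c → (1ℤ ℤ.- + 2 ℤ.* b) ℤ.* 0ℤ ≡ ℤ.- ((1ℤ ℤ.- + 2 ℤ.* c) ℤ.* 0ℤ)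
    vanish = solve-∀

    signed-σ : ∀ x → signed (σ x) ≡ ℤ.- signed x
    signed-σ x with p x ℤₚ.≟ 0ℤ
    ... | yes px≡0 = ≡.subst₂ (λ u v → (1ℤ ℤ.- + 2 ℤ.* before (σ x)) ℤ.* u ≡ ℤ.- ((1ℤ ℤ.- + 2 ℤ.* before x) ℤ.* v))
                       (≡.sym (≡.trans (pσ x) px≡0)) (≡.sym px≡0) (vanish (before (σ x)) (before x))
    ... | no px≢0  = ≡.trans (≡.cong₂ (λ b v → (1ℤ ℤ.- + 2 ℤ.* b) ℤ.* v) before-σ (pσ x)) (flip (before x) (p x))
      where
      before-σ : before (σ x) ≡ 1ℤ ℤ.- before x
      before-σ = ≡.trans (≡.cong (λ i → ind (i Finₚ.<? index (σ x))) (index-cong (σσ x)))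
                         (<-flip (λ σi≡i → px≢0 (p-fix x (trans (sym (el-index (σ x)))
                                                      (trans (reflexive (≡.cong el σi≡i)) (el-index x))))))

    signed-resp : Respects signed
    signed-resp x≈y = ≡.cong₂ (λ b v → (1ℤ ℤ.- + 2 ℤ.* b) ℤ.* v)
      (≡.cong₂ (λ i j → ind (i Finₚ.<? j)) (index-cong (σ-cong x≈y)) (index-cong x≈y)) (p-resp x≈y)

    Σsigned≡0 : Σ signed ≡ 0ℤ
    Σsigned≡0 = self≡neg⇒0 _ (≡.trans (≡.sym (Σ-reindex σ σ σ-cong σ-cong σσ σσ signed signed-resp))
                                      (≡.trans (Σ-cong signed-σ) (Σ-neg signed)))

  δ : Carrier → Carrier → ℤ
  δ a x = ind (x ≈? a)

  δ-resp : ∀ a → Respects (δ a)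
  δ-resp a {x} {y} x≈y = ind-cong (x ≈? a) (y ≈? a) (trans (sym x≈y)) (trans x≈y)

  Σδ : ∀ a → Σ (δ a) ≡ 1ℤ
  Σδ a = ≡.trans (Σ-single (δ a) (δ-resp a) a (λ x x≉a → ind-no x≉a (x ≈? a))) (ind-yes refl (a ≈? a))

  Σδ-flip : ∀ x → Σ (λ a → δ a x) ≡ 1ℤ
  Σδ-flip x = ≡.trans (Σ-cong (λ a → ind-cong (x ≈? a) (a ≈? x) sym sym)) (Σδ x)

  Σ1-δ : ∀ a → Σ (λ x → 1ℤ ℤ.- δ a x) ≡ + q ℤ.- 1ℤ
  Σ1-δ a = ≡.trans (Σ-+ (λ _ → 1ℤ) (λ x → ℤ.- δ a x))
                   (≡.cong₂ ℤ._+_ (≡.trans (Σ-const 1ℤ) (ℤₚ.*-identityʳ (+ q))) (≡.trans (Σ-neg (δ a)) (≡.cong ℤ.-_ (Σδ a))))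

  Σ-∘-*ˡ : ∀ {a} → ¬ (a ≈ 0#) → ∀ f → Respects f → Σ (λ x → f (a * x)) ≡ Σ f
  Σ-∘-*ˡ {a} a≉0 = Σ-reindex (a *_) (a ⁻¹ *_) *-congˡ *-congˡ (cancel (⁻¹-inverseʳ a≉0)) (cancel (⁻¹-inverseˡ a≉0))
    where
    cancel : ∀ {b c} → b * c ≈ 1# → ∀ x → b * (c * x) ≈ x
    cancel bc≈1 x = trans (sym (*-assoc _ _ x)) (trans (*-congʳ bc≈1) (*-identityˡ x))

  Σ-∘-+ʳ : ∀ a f → Respects f → Σ (λ x → f (x + a)) ≡ Σ f
  Σ-∘-+ʳ a = Σ-reindex (_+ a) (_- a) +-congʳ +-congʳ
    (λ x → solve 2 (λ x a → (x :- a) :+ a := x) refl x a) (λ x → solve 2 (λ x a → (x :+ a) :- a := x) refl x a)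

  Σ-∘-⁻¹ : ∀ f → Respects f → Σ (λ x → f (x ⁻¹)) ≡ Σ f
  Σ-∘-⁻¹ = Σ-reindex _⁻¹ _⁻¹ ⁻¹-cong ⁻¹-cong ⁻¹-involutive ⁻¹-involutive

  Σ-*-Σ : ∀ f g → Σ f ℤ.* Σ g ≡ Σ (λ x → Σ (λ y → f x ℤ.* g y))
  Σ-*-Σ f g = ≡.trans (ℤₚ.*-comm (Σ f) (Σ g))
             (≡.trans (≡.sym (Σ-*ˡ (Σ g) f))
                      (Σ-cong (λ x → ≡.trans (ℤₚ.*-comm (Σ g) (f x)) (≡.sym (Σ-*ˡ (f x) g)))))

module QuadraticCharacter {c ℓ} (F : CommutativeRing c ℓ) {q : ℕ} (isFF : IsFiniteField F q) where

  open import Level using (_⊔_)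
  open import Data.Empty using (⊥-elim)
  open import Data.Integer.Base as ℤ using (ℤ; +_; 0ℤ; 1ℤ; -1ℤ)
  open import Data.Nat.Base using (z≤n)
  open import Data.Product.Base using (_,_; proj₁; proj₂)
  open import Function.Base using (_∘_)
  import Relation.Binary.PropositionalEquality as ≡
  open import Relation.Nullary.Decidable using (Dec; yes; no)
  open import Relation.Nullary.Negation using (¬_)

  open Indicator
  open IntegerCoefficients F using (solve; _:=_; _:*_; con)

  open CommutativeRing F
  open FiniteField F isFF
  open FieldSums F isFF

  data SquareClass (x : Carrier) : Set (c ⊔ ℓ) where
    isZero : x ≈ 0# → SquareClass x
    isQR   : QR F x → SquareClass x
    isNQR  : NQR F x → SquareClass x

  opaque
    classify : ∀ x → SquareClass x
    classify x with x ≈? 0#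
    ... | yes x≈0 = isZero x≈0
    ... | no x≉0 with ∃? (λ y → y * y ≈? x) (λ y≈z yy≈x → trans (*-cong (sym y≈z) (sym y≈z)) yy≈x)
    ...   | yes root = isQR (x≉0 , root)
    ...   | no ¬root = isNQR (x≉0 , ¬root ∘ proj₂)

  QR-cong : ∀ {x y} → x ≈ y → QR F x → QR F y
  QR-cong x≈y (x≉0 , r , rr≈x) = x≉0 ∘ trans x≈y , r , trans rr≈x x≈y

  NQR-cong : ∀ {x y} → x ≈ y → NQR F x → NQR F y
  NQR-cong x≈y (x≉0 , ¬qx) = x≉0 ∘ trans x≈y , ¬qx ∘ QR-cong (sym x≈y)

  SquareClass-cong : ∀ {x y} → x ≈ y → SquareClass x → SquareClass y
  SquareClass-cong x≈y (isZero x≈0) = isZero (trans (sym x≈y) x≈0)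
  SquareClass-cong x≈y (isQR qx)    = isQR (QR-cong x≈y qx)
  SquareClass-cong x≈y (isNQR nx)   = isNQR (NQR-cong x≈y nx)

  QR? : ∀ x → Dec (QR F x)
  QR? x with classify x
  ... | isZero x≈0 = no λ qx → proj₁ qx x≈0
  ... | isQR qx    = yes qx
  ... | isNQR nx   = no (proj₂ nx)

  NQR? : ∀ x → Dec (NQR F x)
  NQR? x with classify x
  ... | isZero x≈0 = no λ nx → proj₁ nx x≈0
  ... | isQR qx    = no λ nx → proj₂ nx qx
  ... | isNQR nx   = yes nx

  classValue : ∀ {x} → SquareClass x → ℤ
  classValue (isZero _) = 0ℤ
  classValue (isQR _)   = 1ℤ
  classValue (isNQR _)  = -1ℤ

  χ : Carrier → ℤ
  χ x = classValue (classify x)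

  classValue-unique : ∀ {x} (k l : SquareClass x) → classValue k ≡ classValue l
  classValue-unique (isZero _)        (isZero _)        = ≡.refl
  classValue-unique (isZero x≈0)      (isQR (x≉0 , _))  = ⊥-elim (x≉0 x≈0)
  classValue-unique (isZero x≈0)      (isNQR (x≉0 , _)) = ⊥-elim (x≉0 x≈0)
  classValue-unique (isQR (x≉0 , _))  (isZero x≈0)      = ⊥-elim (x≉0 x≈0)
  classValue-unique (isQR _)          (isQR _)          = ≡.refl
  classValue-unique (isQR qx)         (isNQR (_ , ¬qx)) = ⊥-elim (¬qx qx)
  classValue-unique (isNQR (x≉0 , _)) (isZero x≈0)      = ⊥-elim (x≉0 x≈0)
  classValue-unique (isNQR (_ , ¬qx)) (isQR qx)         = ⊥-elim (¬qx qx)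
  classValue-unique (isNQR _)         (isNQR _)         = ≡.refl

  χ-≈0 : ∀ {x} → x ≈ 0# → χ x ≡ 0ℤ
  χ-≈0 {x} x≈0 = classValue-unique (classify x) (isZero x≈0)

  χ-QR : ∀ {x} → QR F x → χ x ≡ 1ℤ
  χ-QR {x} qx = classValue-unique (classify x) (isQR qx)

  χ-NQR : ∀ {x} → NQR F x → χ x ≡ -1ℤ
  χ-NQR {x} nx = classValue-unique (classify x) (isNQR nx)

  χ-cong : Respects χ
  χ-cong {x} {y} x≈y = ≡.trans (transported (classify x)) (classValue-unique (SquareClass-cong x≈y (classify x)) (classify y))
    where
    transported : (k : SquareClass x) → classValue k ≡ classValue (SquareClass-cong x≈y k)
    transported (isZero _) = ≡.refl
    transported (isQR _)   = ≡.refl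
    transported (isNQR _)  = ≡.refl

  χ≡1⇒QR : ∀ {x} → χ x ≡ 1ℤ → QR F x
  χ≡1⇒QR {x} = from-class (classify x)
    where
    from-class : (k : SquareClass x) → classValue k ≡ 1ℤ → QR F x
    from-class (isQR qx) _ = qx

  χ≡-1⇒NQR : ∀ {x} → χ x ≡ -1ℤ → NQR F x
  χ≡-1⇒NQR {x} = from-class (classify x)
    where
    from-class : (k : SquareClass x) → classValue k ≡ -1ℤ → NQR F x
    from-class (isNQR nx) _ = nx

  χ*χ≡1 : ∀ {x} → ¬ (x ≈ 0#) → χ x ℤ.* χ x ≡ 1ℤ
  χ*χ≡1 {x} x≉0 = by-class (classify x)
    where
    by-class : (k : SquareClass x) → classValue k ℤ.* classValue k ≡ 1ℤ
    by-class (isZero x≈0) = ⊥-elim (x≉0 x≈0)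
    by-class (isQR _)     = ≡.refl
    by-class (isNQR _)    = ≡.refl

  1-χ≥0 : ∀ x → 0ℤ ℤ.≤ 1ℤ ℤ.- χ x
  1-χ≥0 x with classify x
  ... | isZero _ = ℤ.+≤+ z≤n
  ... | isQR _   = ℤ.+≤+ z≤n
  ... | isNQR _  = ℤ.+≤+ z≤n

  QR-1 : QR F 1#
  QR-1 = one≉zero , 1# , *-identityˡ 1#

  QR-* : ∀ {x y} → QR F x → QR F y → QR F (x * y)
  QR-* (x≉0 , r , rr≈x) (y≉0 , s , ss≈y) =
    *-≉0 x≉0 y≉0 , r * s , trans (solve 2 (λ r s → (r :* s) :* (r :* s) := (r :* r) :* (s :* s)) refl r s) (*-cong rr≈x ss≈y)

  QR-*-NQR : ∀ {x y} → QR F x → NQR F y → NQR F (x * y)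
  QR-*-NQR {x} {y} (x≉0 , r , rr≈x) (y≉0 , ¬qy) = *-≉0 x≉0 y≉0 , λ (_ , s , ss≈xy) → ¬qy (y≉0 , s * r ⁻¹ , root s ss≈xy)
    where
    r≉0 : ¬ (r ≈ 0#)
    r≉0 r≈0 = x≉0 (trans (sym rr≈x) (trans (*-congʳ r≈0) (zeroˡ r)))
    root : ∀ s → s * s ≈ x * y → (s * r ⁻¹) * (s * r ⁻¹) ≈ y
    root s ss≈xy = begin
      (s * r ⁻¹) * (s * r ⁻¹)
        ≈⟨ solve 2 (λ s i → (s :* i) :* (s :* i) := (s :* s) :* (i :* i)) refl s (r ⁻¹) ⟩
      (s * s) * (r ⁻¹ * r ⁻¹)
        ≈⟨ *-congʳ (trans ss≈xy (*-congʳ (sym rr≈x))) ⟩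
      ((r * r) * y) * (r ⁻¹ * r ⁻¹)
        ≈⟨ solve 3 (λ r i y → ((r :* r) :* y) :* (i :* i) := ((r :* i) :* (r :* i)) :* y) refl r (r ⁻¹) y ⟩
      ((r * r ⁻¹) * (r * r ⁻¹)) * y
        ≈⟨ *-congʳ (*-cong (⁻¹-inverseʳ r≉0) (⁻¹-inverseʳ r≉0)) ⟩
      (1# * 1#) * y
        ≈⟨ solve 1 (λ y → (con (+ 1) :* con (+ 1)) :* y := y) refl y ⟩
      y ∎
      where open ≈-Reasoning

  NQR-*-QR : ∀ {x y} → NQR F x → QR F y → NQR F (x * y)
  NQR-*-QR nx qy = NQR-cong (*-comm _ _) (QR-*-NQR qy nx)

  𝟙QR : Carrier → ℤ
  𝟙QR x = ind (QR? x)

  𝟙NQR : Carrier → ℤ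
  𝟙NQR x = ind (NQR? x)

  𝟙QR-resp : Respects 𝟙QR
  𝟙QR-resp x≈y = ind-cong (QR? _) (QR? _) (QR-cong x≈y) (QR-cong (sym x≈y))

  𝟙NQR-resp : Respects 𝟙NQR
  𝟙NQR-resp x≈y = ind-cong (NQR? _) (NQR? _) (NQR-cong x≈y) (NQR-cong (sym x≈y))

  χ≡𝟙QR-𝟙NQR : ∀ x → χ x ≡ 𝟙QR x ℤ.- 𝟙NQR x
  χ≡𝟙QR-𝟙NQR x with classify x
  ... | isZero _ = ≡.refl
  ... | isQR _   = ≡.refl
  ... | isNQR _  = ≡.refl

  δ0+𝟙QR+𝟙NQR≡1 : ∀ x → δ 0# x ℤ.+ 𝟙QR x ℤ.+ 𝟙NQR x ≡ 1ℤ
  δ0+𝟙QR+𝟙NQR≡1 x with classify x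
  ... | isZero x≈0 rewrite ind-yes x≈0 (x ≈? 0#)       = ≡.refl
  ... | isQR qx    rewrite ind-no (proj₁ qx) (x ≈? 0#) = ≡.refl
  ... | isNQR nx   rewrite ind-no (proj₁ nx) (x ≈? 0#) = ≡.refl

  χ*χ≡1-δ0 : ∀ x → χ x ℤ.* χ x ≡ 1ℤ ℤ.- δ 0# x
  χ*χ≡1-δ0 x with classify x
  ... | isZero x≈0 rewrite ind-yes x≈0 (x ≈? 0#)         = ≡.refl
  ... | isQR qx    rewrite ind-no (proj₁ qx) (x ≈? 0#)   = ≡.refl
  ... | isNQR nx   rewrite ind-no (proj₁ nx) (x ≈? 0#)   = ≡.refl

  Σχ*χ : Σ (λ x → χ x ℤ.* χ x) ≡ + q ℤ.- 1ℤ
  Σχ*χ = ≡.trans (Σ-cong χ*χ≡1-δ0) (Σ1-δ 0#)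

module OddOrder {c ℓ} (F : CommutativeRing c ℓ) {q : ℕ} (isFF : IsFiniteField F q) {m : ℕ} (q≡1+2m : q ≡ suc (2 ℕ.* m)) where

  open import Data.Empty using (⊥; ⊥-elim)
  open import Data.Integer.Base as ℤ using (ℤ; +_; 0ℤ; 1ℤ; -1ℤ)
  import Data.Integer.Properties as ℤₚ
  open import Data.Integer.Tactic.RingSolver using (solve-∀)
  open IntegerFacts using (nonneg-*; even≢odd)
  open import Algebra.Properties.AbelianGroup ℤₚ.+-0-abelianGroup using (∙-cancelˡ)
  open import Data.Product.Base using (∃-syntax; _,_; proj₁)
  open import Data.Sum.Base using (inj₁; inj₂; [_,_]′)
  open import Function.Base using (_∘_; flip)
  import Relation.Binary.PropositionalEquality as ≡
  open ≡ using (_≢_)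
  open import Relation.Nullary.Decidable using (Dec; yes; no)
  open import Relation.Nullary.Negation using (¬_)

  open CommutativeRing F
  open Indicator
  open FiniteField F isFF
  open FieldSums F isFF
  open QuadraticCharacter F isFF
  open IntegerCoefficients F using (solve; _:=_; _:+_; _:*_; :-_; _:-_; con)

  Σ1≡q : Σ (λ _ → 1ℤ) ≡ 1ℤ ℤ.+ + 2 ℤ.* + m
  Σ1≡q = ≡.trans (Σ-const 1ℤ) (≡.trans (ℤₚ.*-identityʳ (+ q))
           (≡.trans (≡.cong +_ q≡1+2m) (≡.trans (ℤₚ.pos-+ 1 (2 ℕ.* m)) (≡.cong (λ v → 1ℤ ℤ.+ v) (ℤₚ.pos-* 2 m)))))

  -- If 2 ≈ 0, translation by 1 is a fixed-point-free involution, so q would be even.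
  2≉0 : ¬ (2# ≈ 0#)
  2≉0 2≈0 = parity-clash (involution-sum-even (_+ 1#) +-congʳ shift-involutive
                                                (λ _ → 1ℤ) (λ _ → ≡.refl) (λ _ → ≡.refl) shift-moves)
    where
    shift-involutive : ∀ x → (x + 1#) + 1# ≈ x
    shift-involutive x = trans (solve 1 (λ x → (x :+ con (+ 1)) :+ con (+ 1) := x :+ (con (+ 1) :+ con (+ 1))) refl x)
                               (trans (+-congˡ 2≈0) (+-identityʳ x))
    shift-moves : ∀ x → x + 1# ≈ x → 1ℤ ≡ 0ℤ
    shift-moves x x+1≈x = ⊥-elim (one≉zero (trans (solve 1 (λ x → con (+ 1) := (x :+ con (+ 1)) :- x) refl x)
                                                   (trans (+-congʳ x+1≈x) (-‿inverseʳ x))))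
    parity-clash : ∃[ k ] Σ (λ _ → 1ℤ) ≡ + 2 ℤ.* k → ⊥
    parity-clash (k , Σ1≡2k) = even≢odd k (+ m) (≡.trans (≡.sym Σ1≡2k) Σ1≡q)

  x≉-x : ∀ {x} → ¬ (x ≈ 0#) → ¬ (x ≈ - x)
  x≉-x {x} x≉0 x≈-x with *≈0⇒ (begin
      2# * x         ≈⟨ solve 1 (λ x → (con (+ 1) :+ con (+ 1)) :* x := x :+ x) refl x ⟩
      x + x          ≈⟨ +-congˡ x≈-x ⟩
      x - x          ≈⟨ -‿inverseʳ x ⟩
      0#             ∎)
    where open ≈-Reasoning
  ... | inj₁ 2≈0 = 2≉0 2≈0
  ... | inj₂ x≈0 = x≉0 x≈0

  #square-roots : ∀ a → Σ (λ x → δ a (x * x)) ≡ 1ℤ ℤ.+ χ a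
  #square-roots a with classify a
  ... | isZero a≈0 = ≡.trans (Σ-cong (λ x → ind-cong (x * x ≈? a) (x ≈? 0#) (x*x≈0⇒x≈0 ∘ flip trans a≈0) (x≈0⇒xx≈a)))
                             (Σδ 0#)
    where
    x≈0⇒xx≈a : ∀ {x} → x ≈ 0# → x * x ≈ a
    x≈0⇒xx≈a {x} x≈0 = trans (*-congʳ x≈0) (trans (zeroˡ x) (sym a≈0))
  ... | isNQR (a≉0 , ¬qa) = Σ-zero (λ x → ind-no (λ xx≈a → ¬qa (a≉0 , x , xx≈a)) (x * x ≈? a))
  ... | isQR (a≉0 , r , rr≈a) = begin
    Σ (λ x → δ a (x * x))                ≡⟨ Σ-cong roots ⟩
    Σ (λ x → δ r x ℤ.+ δ (- r) x)        ≡⟨ Σ-+ (δ r) (δ (- r)) ⟩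
    Σ (δ r) ℤ.+ Σ (δ (- r))              ≡⟨ ≡.cong₂ ℤ._+_ (Σδ r) (Σδ (- r)) ⟩
    1ℤ ℤ.+ 1ℤ                            ∎
    where
    open ≡.≡-Reasoning
    r≉0 : ¬ (r ≈ 0#)
    r≉0 r≈0 = a≉0 (trans (sym rr≈a) (trans (*-congʳ r≈0) (zeroˡ r)))
    roots : ∀ x → δ a (x * x) ≡ δ r x ℤ.+ δ (- r) x
    roots x with x ≈? r | x ≈? - r
    ... | yes x≈r | yes x≈-r = ⊥-elim (x≉-x r≉0 (trans (sym x≈r) x≈-r))
    ... | yes x≈r | no _     = ind-yes (trans (*-cong x≈r x≈r) rr≈a) (x * x ≈? a)
    ... | no _    | yes x≈-r = ind-yes (trans (*-cong x≈-r x≈-r) (trans (solve 1 (λ r → (:- r) :* (:- r) := r :* r) refl r) rr≈a))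
                                       (x * x ≈? a)
    ... | no x≉r  | no x≉-r  = ind-no (λ xx≈a → [ x≉r , x≉-r ]′ (x*x≈y*y⇒ (trans rr≈a (sym xx≈a)))) (x * x ≈? a)


  Σχ≡0 : Σ χ ≡ 0ℤ
  Σχ≡0 = ∙-cancelˡ (Σ (λ _ → 1ℤ)) (Σ χ) 0ℤ (begin
    Σ (λ _ → 1ℤ) ℤ.+ Σ χ                      ≡⟨ Σ-+ (λ _ → 1ℤ) χ ⟨
    Σ (λ a → 1ℤ ℤ.+ χ a)                      ≡⟨ Σ-cong #square-roots ⟨
    Σ (λ a → Σ (λ x → δ a (x * x)))           ≡⟨ Σ-comm (λ a x → δ a (x * x)) ⟩
    Σ (λ x → Σ (λ a → δ a (x * x)))           ≡⟨ Σ-cong (λ x → Σδ-flip (x * x)) ⟩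
    Σ (λ _ → 1ℤ)                              ≡⟨ ℤₚ.+-identityʳ _ ⟨
    Σ (λ _ → 1ℤ) ℤ.+ 0ℤ                       ∎)
    where open ≡.≡-Reasoning

  Σ𝟙QR≡Σ𝟙NQR : Σ 𝟙QR ≡ Σ 𝟙NQR
  Σ𝟙QR≡Σ𝟙NQR = ℤₚ.i-j≡0⇒i≡j _ _ (begin
    Σ 𝟙QR ℤ.- Σ 𝟙NQR                      ≡⟨ ≡.cong (λ v → Σ 𝟙QR ℤ.+ v) (Σ-neg 𝟙NQR) ⟨
    Σ 𝟙QR ℤ.+ Σ (λ x → ℤ.- 𝟙NQR x)         ≡⟨ Σ-+ 𝟙QR (λ x → ℤ.- 𝟙NQR x) ⟨
    Σ (λ x → 𝟙QR x ℤ.- 𝟙NQR x)             ≡⟨ Σ-cong χ≡𝟙QR-𝟙NQR ⟨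
    Σ χ                                    ≡⟨ Σχ≡0 ⟩
    0ℤ                                     ∎)
    where open ≡.≡-Reasoning

  Σ𝟙QR≡m : Σ 𝟙QR ≡ + m
  Σ𝟙QR≡m = ℤₚ.*-cancelˡ-≡ (+ 2) _ _ (∙-cancelˡ 1ℤ _ _ (begin
    1ℤ ℤ.+ + 2 ℤ.* Σ 𝟙QR                                ≡⟨ count (Σ 𝟙QR) ⟩
    Σ (δ 0#) ℤ.+ Σ 𝟙QR ℤ.+ Σ 𝟙QR                        ≡⟨ ≡.cong (λ v → Σ (δ 0#) ℤ.+ Σ 𝟙QR ℤ.+ v) Σ𝟙QR≡Σ𝟙NQR ⟩
    Σ (δ 0#) ℤ.+ Σ 𝟙QR ℤ.+ Σ 𝟙NQR                       ≡⟨ ≡.cong (ℤ._+ Σ 𝟙NQR) (Σ-+ (δ 0#) 𝟙QR) ⟨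
    Σ (λ x → δ 0# x ℤ.+ 𝟙QR x) ℤ.+ Σ 𝟙NQR               ≡⟨ Σ-+ (λ x → δ 0# x ℤ.+ 𝟙QR x) 𝟙NQR ⟨
    Σ (λ x → δ 0# x ℤ.+ 𝟙QR x ℤ.+ 𝟙NQR x)               ≡⟨ Σ-cong δ0+𝟙QR+𝟙NQR≡1 ⟩
    Σ (λ _ → 1ℤ)                                        ≡⟨ Σ1≡q ⟩
    1ℤ ℤ.+ + 2 ℤ.* + m                                  ∎))
    where
    open ≡.≡-Reasoning
    count : ∀ s → 1ℤ ℤ.+ + 2 ℤ.* s ≡ Σ (δ 0#) ℤ.+ s ℤ.+ s
    count s = ≡.trans (lemma s) (≡.cong (λ v → v ℤ.+ s ℤ.+ s) (≡.sym (Σδ 0#)))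
      where
      lemma : ∀ s → 1ℤ ℤ.+ + 2 ℤ.* s ≡ 1ℤ ℤ.+ s ℤ.+ s
      lemma = solve-∀

  -- Multiplication by a nonsquare a sends the squares into the nonsquares; as there are
  -- equally many of each, it must send every nonsquare to a square.
  NQR-*-NQR : ∀ {a b} → NQR F a → NQR F b → QR F (a * b)
  NQR-*-NQR {a} {b} na nb = χ≡1⇒QR (≡.sym (ℤₚ.i-j≡0⇒i≡j 1ℤ (t b) (≡.trans (≡.sym (ℤₚ.*-identityˡ _)) h[b]≡0)))
    where
    open ≡.≡-Reasoning
    t : Carrier → ℤ
    t x = χ (a * x)

    t-split : ∀ x → t x ≡ 𝟙NQR x ℤ.* t x ℤ.- 𝟙QR x
    t-split x with classify x
    ... | isZero x≈0 = χ-≈0 (trans (*-congˡ x≈0) (zeroʳ a))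
    ... | isQR qx    = χ-NQR (NQR-*-QR na qx)
    ... | isNQR _    = ≡.sym (≡.trans (ℤₚ.+-identityʳ _) (ℤₚ.*-identityˡ _))

    Σ𝟙NQR·t : Σ (λ x → 𝟙NQR x ℤ.* t x) ≡ Σ 𝟙NQR
    Σ𝟙NQR·t = ≡.trans (ℤₚ.i-j≡0⇒i≡j _ _ (begin
      Σ (λ x → 𝟙NQR x ℤ.* t x) ℤ.- Σ 𝟙QR
        ≡⟨ ≡.cong (λ v → Σ (λ x → 𝟙NQR x ℤ.* t x) ℤ.+ v) (Σ-neg 𝟙QR) ⟨
      Σ (λ x → 𝟙NQR x ℤ.* t x) ℤ.+ Σ (ℤ.-_ ∘ 𝟙QR)
        ≡⟨ Σ-+ (λ x → 𝟙NQR x ℤ.* t x) (ℤ.-_ ∘ 𝟙QR) ⟨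
      Σ (λ x → 𝟙NQR x ℤ.* t x ℤ.- 𝟙QR x)
        ≡⟨ Σ-cong t-split ⟨
      Σ t
        ≡⟨ Σ-∘-*ˡ (proj₁ na) χ χ-cong ⟩
      Σ χ
        ≡⟨ Σχ≡0 ⟩
      0ℤ ∎)) Σ𝟙QR≡Σ𝟙NQR

    h : Carrier → ℤ
    h x = 𝟙NQR x ℤ.* (1ℤ ℤ.- t x)

    Σh≡0 : Σ h ≡ 0ℤ
    Σh≡0 = begin
      Σ h
        ≡⟨ Σ-cong (λ x → expand (𝟙NQR x) (t x)) ⟩
      Σ (λ x → 𝟙NQR x ℤ.+ ℤ.- (𝟙NQR x ℤ.* t x))
        ≡⟨ Σ-+ 𝟙NQR (λ x → ℤ.- (𝟙NQR x ℤ.* t x)) ⟩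
      Σ 𝟙NQR ℤ.+ Σ (λ x → ℤ.- (𝟙NQR x ℤ.* t x))
        ≡⟨ ≡.cong (λ v → Σ 𝟙NQR ℤ.+ v) (Σ-neg (λ x → 𝟙NQR x ℤ.* t x)) ⟩
      Σ 𝟙NQR ℤ.- Σ (λ x → 𝟙NQR x ℤ.* t x)
        ≡⟨ ≡.cong (λ v → Σ 𝟙NQR ℤ.- v) Σ𝟙NQR·t ⟩
      Σ 𝟙NQR ℤ.- Σ 𝟙NQR
        ≡⟨ ℤₚ.+-inverseʳ (Σ 𝟙NQR) ⟩
      0ℤ ∎
      where
      expand : ∀ i v → i ℤ.* (1ℤ ℤ.- v) ≡ i ℤ.+ ℤ.- (i ℤ.* v)
      expand = solve-∀

    h[b]≡0 : 1ℤ ℤ.* (1ℤ ℤ.- t b) ≡ 0ℤ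
    h[b]≡0 = ≡.trans (≡.cong (ℤ._* (1ℤ ℤ.- t b)) (≡.sym (ind-yes nb (NQR? b))))
                     (Σ-nonneg-≡0 h-resp (λ x → nonneg-* (ind-nonneg (NQR? x)) (1-χ≥0 (a * x))) Σh≡0 b)
      where
      h-resp : Respects h
      h-resp x≈y = ≡.cong₂ (λ i v → i ℤ.* (1ℤ ℤ.- v)) (𝟙NQR-resp x≈y) (χ-cong (*-congˡ x≈y))

  χ-* : ∀ x y → χ (x * y) ≡ χ x ℤ.* χ y
  χ-* x y with classify x | classify y
  ... | isZero x≈0 | _          = χ-≈0 (trans (*-congʳ x≈0) (zeroˡ y))
  ... | isQR _     | isZero y≈0 = χ-≈0 (trans (*-congˡ y≈0) (zeroʳ x))
  ... | isNQR _    | isZero y≈0 = χ-≈0 (trans (*-congˡ y≈0) (zeroʳ x))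
  ... | isQR qx    | isQR qy    = χ-QR (QR-* qx qy)
  ... | isQR qx    | isNQR ny   = χ-NQR (QR-*-NQR qx ny)
  ... | isNQR nx   | isQR qy    = χ-NQR (NQR-*-QR nx qy)
  ... | isNQR nx   | isNQR ny   = χ-QR (NQR-*-NQR nx ny)

  χ-⁻¹ : ∀ x → χ (x ⁻¹) ≡ χ x
  χ-⁻¹ x = by-cases (x ≈? 0#)
    where
    open ≡.≡-Reasoning
    by-cases : Dec (x ≈ 0#) → χ (x ⁻¹) ≡ χ x
    by-cases (yes x≈0) = ≡.trans (χ-≈0 (0⁻¹≈0 x≈0)) (≡.sym (χ-≈0 x≈0))
    by-cases (no x≉0)  = begin
      χ (x ⁻¹)                    ≡⟨ χ-cong x⁻¹≈x·x⁻¹² ⟩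
      χ (x * (x ⁻¹ * x ⁻¹))       ≡⟨ χ-* x _ ⟩
      χ x ℤ.* χ (x ⁻¹ * x ⁻¹)     ≡⟨ ≡.cong (χ x ℤ.*_) (χ-QR (*-≉0 x⁻¹≉0 x⁻¹≉0 , x ⁻¹ , refl)) ⟩
      χ x ℤ.* 1ℤ                  ≡⟨ ℤₚ.*-identityʳ (χ x) ⟩
      χ x                         ∎
      where
      x⁻¹≉0 : ¬ (x ⁻¹ ≈ 0#)
      x⁻¹≉0 = ⁻¹-≉0 x≉0
      x⁻¹≈x·x⁻¹² : x ⁻¹ ≈ x * (x ⁻¹ * x ⁻¹)
      x⁻¹≈x·x⁻¹² = sym (trans (sym (*-assoc _ _ _)) (trans (*-congʳ (⁻¹-inverseʳ x≉0)) (*-identityˡ _)))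

  -- The substitution a ↦ a⁻¹ turns χ(a) χ(a + d) into χ(d a + 1), whose sum is Σ χ.
  Σχχ-shift≡-1 : ∀ {d} → ¬ (d ≈ 0#) → Σ (λ a → χ a ℤ.* χ (a + d)) ≡ -1ℤ
  Σχχ-shift≡-1 {d} d≉0 = begin
    Σ f
      ≡⟨ Σ-∘-⁻¹ f f-resp ⟨
    Σ (λ a → f (a ⁻¹))
      ≡⟨ Σ-cong inverted ⟩
    Σ (λ a → χ (d * a + 1#) ℤ.- δ 0# a)
      ≡⟨ Σ-+ (λ a → χ (d * a + 1#)) (λ a → ℤ.- δ 0# a) ⟩
    Σ (λ a → χ (d * a + 1#)) ℤ.+ Σ (λ a → ℤ.- δ 0# a)
      ≡⟨ ≡.cong₂ ℤ._+_ Σχ-affine (≡.trans (Σ-neg (δ 0#)) (≡.cong ℤ.-_ (Σδ 0#))) ⟩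
    0ℤ ℤ.- 1ℤ ∎
    where
    open ≡.≡-Reasoning
    f : Carrier → ℤ
    f a = χ a ℤ.* χ (a + d)
    f-resp : Respects f
    f-resp a≈b = ≡.cong₂ ℤ._*_ (χ-cong a≈b) (χ-cong (+-congʳ a≈b))

    Σχ-affine : Σ (λ a → χ (d * a + 1#)) ≡ 0ℤ
    Σχ-affine = ≡.trans (Σ-∘-*ˡ d≉0 (λ y → χ (y + 1#)) (χ-cong ∘ +-congʳ)) (≡.trans (Σ-∘-+ʳ 1# χ χ-cong) Σχ≡0)

    inverted : ∀ a → f (a ⁻¹) ≡ χ (d * a + 1#) ℤ.- δ 0# a
    inverted a with a ≈? 0#
    ... | yes a≈0 = begin
      χ (a ⁻¹) ℤ.* χ (a ⁻¹ + d)     ≡⟨ ≡.cong (ℤ._* χ (a ⁻¹ + d)) (χ-≈0 (0⁻¹≈0 a≈0)) ⟩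
      0ℤ                            ≡⟨ ≡.cong (ℤ._- 1ℤ) (≡.trans (χ-cong d·0+1≈1) (χ-QR QR-1)) ⟨
      χ (d * a + 1#) ℤ.- 1ℤ         ∎
      where
      d·0+1≈1 : d * a + 1# ≈ 1#
      d·0+1≈1 = trans (+-congʳ (trans (*-congˡ a≈0) (zeroʳ d))) (+-identityˡ 1#)
    ... | no a≉0 = begin
      χ (a ⁻¹) ℤ.* χ (a ⁻¹ + d)
        ≡⟨ ≡.cong (χ (a ⁻¹) ℤ.*_) (≡.trans (χ-cong factor) (χ-* (a ⁻¹) _)) ⟩
      χ (a ⁻¹) ℤ.* (χ (a ⁻¹) ℤ.* χ (d * a + 1#))
        ≡⟨ ℤₚ.*-assoc (χ (a ⁻¹)) _ _ ⟨
      χ (a ⁻¹) ℤ.* χ (a ⁻¹) ℤ.* χ (d * a + 1#)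
        ≡⟨ ≡.cong (ℤ._* χ (d * a + 1#)) (χ*χ≡1 (⁻¹-≉0 a≉0)) ⟩
      1ℤ ℤ.* χ (d * a + 1#)
        ≡⟨ ℤₚ.*-identityˡ _ ⟩
      χ (d * a + 1#)
        ≡⟨ ℤₚ.+-identityʳ _ ⟨
      χ (d * a + 1#) ℤ.- 0ℤ ∎
      where
      factor : a ⁻¹ + d ≈ a ⁻¹ * (d * a + 1#)
      factor = sym (trans (solve 3 (λ i d a → i :* (d :* a :+ con (+ 1)) := d :* (i :* a) :+ i) refl (a ⁻¹) d a)
                          (trans (+-congʳ (trans (*-congˡ (⁻¹-inverseˡ a≉0)) (*-identityʳ d))) (+-comm d (a ⁻¹))))

module OneModFour {c ℓ} (F : CommutativeRing c ℓ) {q : ℕ} (isFF : IsFiniteField F q) {u : ℕ} (q≡1+4u : q ≡ suc (4 ℕ.* u)) where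

  open import Level using (_⊔_)

  open import Data.Empty using (⊥; ⊥-elim)
  open import Data.Integer.Base as ℤ using (ℤ; +_; 0ℤ; 1ℤ; -1ℤ)
  import Data.Integer.Properties as ℤₚ
  open import Data.Integer.Tactic.RingSolver using (solve-∀)
  import Data.Nat.Properties as ℕₚ
  open import Data.Product.Base using (∃; ∃₂; ∃-syntax; _×_; _,_; proj₁; proj₂)
  open import Data.Sum.Base using (_⊎_; inj₁; inj₂; [_,_]′)
  open import Function.Base using (_∘_)
  import Relation.Binary.PropositionalEquality as ≡
  open import Relation.Nullary.Decidable using (Dec; yes; no; _×-dec_)
  open import Relation.Nullary.Negation using (¬_)

  open CommutativeRing F
  open Indicator
  open FiniteField F isFF
  open FieldSums F isFF
  open QuadraticCharacter F isFF
  open IntegerCoefficients F using (solve; _:=_; _:+_; _:*_; :-_; _:-_; con)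
  open OddOrder F isFF {2 ℕ.* u} (≡.trans q≡1+4u (≡.cong suc (ℕₚ.*-assoc 2 2 u)))
  open IntegerFacts using (square-nonneg; even≢odd; 2q[q-1]<2n[q-3]²)

  -- Inversion permutes the squares other than 1; its fixed points are ±1, so if -1 were a
  -- nonsquare the number 2u - 1 of these squares would be even.
  QR-−1 : QR F (- 1#)
  QR-−1 with classify (- 1#)
  ... | isZero -1≈0 = ⊥-elim (-1≉0 -1≈0)
  ... | isQR q-1    = q-1
  ... | isNQR n-1   = parity-clash (involution-sum-even _⁻¹ ⁻¹-cong ⁻¹-involutive p p-resp p-⁻¹ p-fixed)
    where
    open ≡.≡-Reasoning
    p : Carrier → ℤ
    p x = 𝟙QR x ℤ.- δ 1# x

    p-resp : Respects p
    p-resp x≈y = ≡.cong₂ ℤ._-_ (𝟙QR-resp x≈y) (δ-resp 1# x≈y)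

    p-⁻¹ : ∀ x → p (x ⁻¹) ≡ p x
    p-⁻¹ x = ≡.cong₂ ℤ._-_ (ind-cong (QR? (x ⁻¹)) (QR? x) (λ qx⁻¹ → χ≡1⇒QR (≡.trans (≡.sym (χ-⁻¹ x)) (χ-QR qx⁻¹)))
                                                            (λ qx → χ≡1⇒QR (≡.trans (χ-⁻¹ x) (χ-QR qx))))
                           (ind-cong (x ⁻¹ ≈? 1#) (x ≈? 1#) ⁻¹≈1⇒≈1 (λ x≈1 → trans (⁻¹-cong x≈1) 1⁻¹≈1))

    p-fixed : ∀ x → x ⁻¹ ≈ x → p x ≡ 0ℤ
    p-fixed x x⁻¹≈x with classify x
    ... | isZero x≈0 rewrite ind-no (λ x≈1 → one≉zero (trans (sym x≈1) x≈0)) (x ≈? 1#) = ≡.refl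
    ... | isNQR nx   rewrite ind-no (λ x≈1 → proj₂ nx (QR-cong (sym x≈1) QR-1)) (x ≈? 1#) = ≡.refl
    ... | isQR qx with x*x≈y*y⇒ (trans (*-identityˡ 1#) (sym (trans (*-congˡ (sym x⁻¹≈x)) (⁻¹-inverseʳ (proj₁ qx)))))
    ...   | inj₁ x≈1  rewrite ind-yes x≈1 (x ≈? 1#) = ≡.refl
    ...   | inj₂ x≈-1 = ⊥-elim (proj₂ n-1 (QR-cong x≈-1 qx))

    Σp≡2u-1 : Σ p ≡ 1ℤ ℤ.+ + 2 ℤ.* (+ u ℤ.- 1ℤ)
    Σp≡2u-1 = begin
      Σ p
        ≡⟨ Σ-+ 𝟙QR (λ x → ℤ.- δ 1# x) ⟩
      Σ 𝟙QR ℤ.+ Σ (λ x → ℤ.- δ 1# x)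
        ≡⟨ ≡.cong₂ ℤ._+_ (≡.trans Σ𝟙QR≡m (ℤₚ.pos-* 2 u)) (≡.trans (Σ-neg (δ 1#)) (≡.cong ℤ.-_ (Σδ 1#))) ⟩
      + 2 ℤ.* + u ℤ.- 1ℤ
        ≡⟨ rearrange (+ u) ⟩
      1ℤ ℤ.+ + 2 ℤ.* (+ u ℤ.- 1ℤ) ∎
      where
      rearrange : ∀ v → + 2 ℤ.* v ℤ.- 1ℤ ≡ 1ℤ ℤ.+ + 2 ℤ.* (v ℤ.- 1ℤ)
      rearrange = solve-∀

    parity-clash : ∃[ k ] Σ p ≡ + 2 ℤ.* k → QR F (- 1#)
    parity-clash (k , Σp≡2k) = ⊥-elim (even≢odd k (+ u ℤ.- 1ℤ) (≡.trans (≡.sym Σp≡2k) Σp≡2u-1))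

  χ-neg : ∀ x → χ (- x) ≡ χ x
  χ-neg x = begin
    χ (- x)                 ≡⟨ χ-cong (solve 1 (λ x → :- x := (:- con (+ 1)) :* x) refl x) ⟩
    χ (- 1# * x)            ≡⟨ χ-* (- 1#) x ⟩
    χ (- 1#) ℤ.* χ x        ≡⟨ ≡.cong (ℤ._* χ x) (χ-QR QR-−1) ⟩
    1ℤ ℤ.* χ x              ≡⟨ ℤₚ.*-identityˡ (χ x) ⟩
    χ x                     ∎
    where open ≡.≡-Reasoning

  φ : Carrier → ℤ
  φ a = Σ (λ x → χ x ℤ.* χ (x * x + a))

  φ-resp : Respects φ
  φ-resp {a} {b} a≈b = Σ-cong {f = λ x → χ x ℤ.* χ (x * x + a)} (λ x → ≡.cong (χ x ℤ.*_) (χ-cong (+-congˡ a≈b)))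

  Σχχ-squares : ∀ x y → Σ (λ a → χ (x * x + a) ℤ.* χ (y * y + a)) ≡ + q ℤ.* δ (y * y) (x * x) ℤ.- 1ℤ
  Σχχ-squares x y = ≡.trans (≡.sym (Σ-∘-+ʳ (- (y * y)) f f-resp)) (≡.trans (Σ-cong shifted) (by-cases (x * x ≈? y * y)))
    where
    open ≡.≡-Reasoning
    f : Carrier → ℤ
    f a = χ (x * x + a) ℤ.* χ (y * y + a)
    f-resp : Respects f
    f-resp a≈b = ≡.cong₂ ℤ._*_ (χ-cong (+-congˡ a≈b)) (χ-cong (+-congˡ a≈b))
    D : Carrier
    D = x * x - y * y
    shifted : ∀ a → f (a - y * y) ≡ χ a ℤ.* χ (a + D)
    shifted a = ≡.trans (≡.cong₂ ℤ._*_ (χ-cong (solve 3 (λ x y a → x :* x :+ (a :- y :* y) := a :+ (x :* x :- y :* y)) refl x y a))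
                                       (χ-cong (solve 2 (λ y a → y :* y :+ (a :- y :* y) := a) refl y a)))
                        (ℤₚ.*-comm (χ (a + D)) (χ a))
    by-cases : (d : Dec (x * x ≈ y * y)) → Σ (λ a → χ a ℤ.* χ (a + D)) ≡ + q ℤ.* ind d ℤ.- 1ℤ
    by-cases (yes xx≈yy) = begin
      Σ (λ a → χ a ℤ.* χ (a + D))
        ≡⟨ Σ-cong (λ a → ≡.cong (χ a ℤ.*_) (χ-cong (trans (+-congˡ D≈0) (+-identityʳ a)))) ⟩
      Σ (λ a → χ a ℤ.* χ a)
        ≡⟨ Σχ*χ ⟩
      + q ℤ.- 1ℤ
        ≡⟨ ≡.cong (ℤ._- 1ℤ) (ℤₚ.*-identityʳ (+ q)) ⟨
      + q ℤ.* 1ℤ ℤ.- 1ℤ ∎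
      where
      D≈0 : D ≈ 0#
      D≈0 = trans (+-congʳ xx≈yy) (-‿inverseʳ (y * y))
    by-cases (no xx≉yy) = begin
      Σ (λ a → χ a ℤ.* χ (a + D))  ≡⟨ Σχχ-shift≡-1 D≉0 ⟩
      -1ℤ                          ≡⟨ ≡.cong (ℤ._- 1ℤ) (ℤₚ.*-zeroʳ (+ q)) ⟨
      + q ℤ.* 0ℤ ℤ.- 1ℤ            ∎
      where
      D≉0 : ¬ (D ≈ 0#)
      D≉0 D≈0 = xx≉yy (trans (solve 2 (λ x y → x :* x := (x :* x :- y :* y) :+ y :* y) refl x y)
                              (trans (+-congʳ D≈0) (+-identityˡ _)))

  Σχ·δsquare : ∀ x → Σ (λ y → χ y ℤ.* δ (y * y) (x * x)) ≡ + 2 ℤ.* χ x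
  Σχ·δsquare x = by-cases (x ≈? 0#)
    where
    open ≡.≡-Reasoning
    by-cases : Dec (x ≈ 0#) → Σ (λ y → χ y ℤ.* δ (y * y) (x * x)) ≡ + 2 ℤ.* χ x
    by-cases (yes x≈0) = ≡.trans (Σ-zero vanish) (≡.cong (+ 2 ℤ.*_) (≡.sym (χ-≈0 x≈0)))
      where
      vanish : ∀ y → χ y ℤ.* δ (y * y) (x * x) ≡ 0ℤ
      vanish y with x * x ≈? y * y
      ... | yes xx≈yy = ≡.trans (≡.cong (ℤ._* 1ℤ) (χ-≈0 (x*x≈0⇒x≈0 (trans (sym xx≈yy) (trans (*-congʳ x≈0) (zeroˡ x)))))) ≡.refl
      ... | no _      = ℤₚ.*-zeroʳ (χ y)
    by-cases (no x≉0) = begin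
      Σ (λ y → χ y ℤ.* δ (y * y) (x * x))
        ≡⟨ Σ-cong roots ⟩
      Σ (λ y → χ y ℤ.* δ x y ℤ.+ χ y ℤ.* δ (- x) y)
        ≡⟨ Σ-+ (λ y → χ y ℤ.* δ x y) (λ y → χ y ℤ.* δ (- x) y) ⟩
      Σ (λ y → χ y ℤ.* δ x y) ℤ.+ Σ (λ y → χ y ℤ.* δ (- x) y)
        ≡⟨ ≡.cong₂ ℤ._+_ (pick x) (≡.trans (pick (- x)) (χ-neg x)) ⟩
      χ x ℤ.+ χ x
        ≡⟨ double (χ x) ⟩
      + 2 ℤ.* χ x ∎
      where
      double : ∀ v → v ℤ.+ v ≡ + 2 ℤ.* v
      double = solve-∀
      pick : ∀ b → Σ (λ y → χ y ℤ.* δ b y) ≡ χ b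
      pick b = ≡.trans (Σ-single (λ y → χ y ℤ.* δ b y) (λ y≈z → ≡.cong₂ ℤ._*_ (χ-cong y≈z) (δ-resp b y≈z)) b
                                 (λ y y≉b → ≡.trans (≡.cong (χ y ℤ.*_) (ind-no y≉b (y ≈? b))) (ℤₚ.*-zeroʳ (χ y))))
                       (≡.trans (≡.cong (χ b ℤ.*_) (ind-yes refl (b ≈? b))) (ℤₚ.*-identityʳ (χ b)))
      only-first : ∀ v → v ℤ.* 1ℤ ≡ v ℤ.* 1ℤ ℤ.+ v ℤ.* 0ℤ
      only-first = solve-∀
      only-second : ∀ v → v ℤ.* 1ℤ ≡ v ℤ.* 0ℤ ℤ.+ v ℤ.* 1ℤ
      only-second = solve-∀
      neither : ∀ v → v ℤ.* 0ℤ ≡ v ℤ.* 0ℤ ℤ.+ v ℤ.* 0ℤ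
      neither = solve-∀
      roots : ∀ y → χ y ℤ.* δ (y * y) (x * x) ≡ χ y ℤ.* δ x y ℤ.+ χ y ℤ.* δ (- x) y
      roots y with y ≈? x | y ≈? - x
      ... | yes y≈x | yes y≈-x = ⊥-elim (x≉-x x≉0 (trans (sym y≈x) y≈-x))
      ... | yes y≈x | no _     rewrite ind-yes (*-cong (sym y≈x) (sym y≈x)) (x * x ≈? y * y) = only-first (χ y)
      ... | no _    | yes y≈-x rewrite ind-yes (sym (trans (*-cong y≈-x y≈-x) (solve 1 (λ x → (:- x) :* (:- x) := x :* x) refl x)))
                                               (x * x ≈? y * y) = only-second (χ y)
      ... | no y≉x  | no y≉-x  rewrite ind-no (λ xx≈yy → [ y≉x , y≉-x ]′ (x*x≈y*y⇒ xx≈yy)) (x * x ≈? y * y)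
                                     = neither (χ y)

  Σχχ·[qδ-1] : ∀ x → Σ (λ y → χ x ℤ.* χ y ℤ.* (+ q ℤ.* δ (y * y) (x * x) ℤ.- 1ℤ)) ≡ + 2 ℤ.* + q ℤ.* (χ x ℤ.* χ x)
  Σχχ·[qδ-1] x = begin
    Σ (λ y → χ x ℤ.* χ y ℤ.* (+ q ℤ.* δ (y * y) (x * x) ℤ.- 1ℤ))
      ≡⟨ Σ-cong (λ y → expand (χ x) (χ y) (+ q) (δ (y * y) (x * x))) ⟩
    Σ (λ y → + q ℤ.* χ x ℤ.* (χ y ℤ.* δ (y * y) (x * x)) ℤ.+ ℤ.- (χ x ℤ.* χ y))
      ≡⟨ Σ-+ (λ y → + q ℤ.* χ x ℤ.* (χ y ℤ.* δ (y * y) (x * x))) (λ y → ℤ.- (χ x ℤ.* χ y)) ⟩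
    Σ (λ y → + q ℤ.* χ x ℤ.* (χ y ℤ.* δ (y * y) (x * x))) ℤ.+ Σ (λ y → ℤ.- (χ x ℤ.* χ y))
      ≡⟨ ≡.cong₂ ℤ._+_ (Σ-*ˡ (+ q ℤ.* χ x) (λ y → χ y ℤ.* δ (y * y) (x * x)))
                       (≡.trans (Σ-neg (λ y → χ x ℤ.* χ y)) (≡.cong ℤ.-_ (Σ-*ˡ (χ x) χ))) ⟩
    + q ℤ.* χ x ℤ.* Σ (λ y → χ y ℤ.* δ (y * y) (x * x)) ℤ.+ ℤ.- (χ x ℤ.* Σ χ)
      ≡⟨ ≡.cong₂ (λ s t → + q ℤ.* χ x ℤ.* s ℤ.+ ℤ.- (χ x ℤ.* t)) (Σχ·δsquare x) Σχ≡0 ⟩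
    + q ℤ.* χ x ℤ.* (+ 2 ℤ.* χ x) ℤ.+ ℤ.- (χ x ℤ.* 0ℤ)
      ≡⟨ collect (+ q) (χ x) ⟩
    + 2 ℤ.* + q ℤ.* (χ x ℤ.* χ x)                                     ∎
    where
    open ≡.≡-Reasoning
    expand : ∀ a b q e → a ℤ.* b ℤ.* (q ℤ.* e ℤ.- 1ℤ) ≡ q ℤ.* a ℤ.* (b ℤ.* e) ℤ.+ ℤ.- (a ℤ.* b)
    expand = solve-∀
    collect : ∀ q a → q ℤ.* a ℤ.* (+ 2 ℤ.* a) ℤ.+ ℤ.- (a ℤ.* 0ℤ) ≡ + 2 ℤ.* q ℤ.* (a ℤ.* a)
    collect = solve-∀

  Σφ*φ : Σ (λ a → φ a ℤ.* φ a) ≡ + 2 ℤ.* + q ℤ.* (+ q ℤ.- 1ℤ)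
  Σφ*φ = begin
    Σ (λ a → φ a ℤ.* φ a)
      ≡⟨ Σ-cong (λ a → Σ-*-Σ (term a) (term a)) ⟩
    Σ (λ a → Σ (λ x → Σ (λ y → term a x ℤ.* term a y)))
      ≡⟨ Σ-comm (λ a x → Σ (λ y → term a x ℤ.* term a y)) ⟩
    Σ (λ x → Σ (λ a → Σ (λ y → term a x ℤ.* term a y)))
      ≡⟨ Σ-cong (λ x → Σ-comm (λ a y → term a x ℤ.* term a y)) ⟩
    Σ (λ x → Σ (λ y → Σ (λ a → term a x ℤ.* term a y)))
      ≡⟨ Σ-cong (λ x → Σ-cong (λ y → factor x y)) ⟩
    Σ (λ x → Σ (λ y → χ x ℤ.* χ y ℤ.* (+ q ℤ.* δ (y * y) (x * x) ℤ.- 1ℤ)))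
      ≡⟨ Σ-cong Σχχ·[qδ-1] ⟩
    Σ (λ x → + 2 ℤ.* + q ℤ.* (χ x ℤ.* χ x))
      ≡⟨ Σ-*ˡ (+ 2 ℤ.* + q) (λ x → χ x ℤ.* χ x) ⟩
    + 2 ℤ.* + q ℤ.* Σ (λ x → χ x ℤ.* χ x)
      ≡⟨ ≡.cong (+ 2 ℤ.* + q ℤ.*_) Σχ*χ ⟩
    + 2 ℤ.* + q ℤ.* (+ q ℤ.- 1ℤ) ∎
    where
    open ≡.≡-Reasoning
    term : Carrier → Carrier → ℤ
    term a x = χ x ℤ.* χ (x * x + a)

    factor : ∀ x y → Σ (λ a → term a x ℤ.* term a y) ≡ χ x ℤ.* χ y ℤ.* (+ q ℤ.* δ (y * y) (x * x) ℤ.- 1ℤ)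
    factor x y = begin
      Σ (λ a → term a x ℤ.* term a y)
        ≡⟨ Σ-cong (λ a → swap (χ x) (χ (x * x + a)) (χ y) (χ (y * y + a))) ⟩
      Σ (λ a → χ x ℤ.* χ y ℤ.* (χ (x * x + a) ℤ.* χ (y * y + a)))
        ≡⟨ Σ-*ˡ (χ x ℤ.* χ y) (λ a → χ (x * x + a) ℤ.* χ (y * y + a)) ⟩
      χ x ℤ.* χ y ℤ.* Σ (λ a → χ (x * x + a) ℤ.* χ (y * y + a))
        ≡⟨ ≡.cong (χ x ℤ.* χ y ℤ.*_) (Σχχ-squares x y) ⟩
      χ x ℤ.* χ y ℤ.* (+ q ℤ.* δ (y * y) (x * x) ℤ.- 1ℤ) ∎
      where
      swap : ∀ a b c d → (a ℤ.* b) ℤ.* (c ℤ.* d) ≡ a ℤ.* c ℤ.* (b ℤ.* d)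
      swap = solve-∀

  φ-square : ∀ {t} → ¬ (t ≈ 0#) → φ (t * t) ≡ χ t ℤ.* φ 1#
  φ-square {t} t≉0 = begin
    φ (t * t)                                               ≡⟨ Σ-∘-*ˡ t≉0 f f-resp ⟨
    Σ (λ x → f (t * x))                                     ≡⟨ Σ-cong scaled ⟩
    Σ (λ x → χ t ℤ.* (χ x ℤ.* χ (x * x + 1#)))              ≡⟨ Σ-*ˡ (χ t) (λ x → χ x ℤ.* χ (x * x + 1#)) ⟩
    χ t ℤ.* φ 1#                                            ∎
    where
    open ≡.≡-Reasoning
    f : Carrier → ℤ
    f x = χ x ℤ.* χ (x * x + t * t)
    f-resp : Respects f
    f-resp x≈y = ≡.cong₂ ℤ._*_ (χ-cong x≈y) (χ-cong (+-congʳ (*-cong x≈y x≈y)))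
    scaled : ∀ x → f (t * x) ≡ χ t ℤ.* (χ x ℤ.* χ (x * x + 1#))
    scaled x = begin
      χ (t * x) ℤ.* χ ((t * x) * (t * x) + t * t)
        ≡⟨ ≡.cong₂ ℤ._*_ (χ-* t x) (≡.trans (χ-cong expand) (χ-* (t * t) _)) ⟩
      χ t ℤ.* χ x ℤ.* (χ (t * t) ℤ.* χ (x * x + 1#))
        ≡⟨ ≡.cong (λ v → χ t ℤ.* χ x ℤ.* (v ℤ.* χ (x * x + 1#))) (≡.trans (χ-* t t) (χ*χ≡1 t≉0)) ⟩
      χ t ℤ.* χ x ℤ.* (1ℤ ℤ.* χ (x * x + 1#))
        ≡⟨ regroup (χ t) (χ x) (χ (x * x + 1#)) ⟩
      χ t ℤ.* (χ x ℤ.* χ (x * x + 1#)) ∎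
      where
      expand : (t * x) * (t * x) + t * t ≈ (t * t) * (x * x + 1#)
      expand = solve 2 (λ t x → (t :* x) :* (t :* x) :+ t :* t := (t :* t) :* (x :* x :+ con (+ 1))) refl t x
      regroup : ∀ a b c → a ℤ.* b ℤ.* (1ℤ ℤ.* c) ≡ a ℤ.* (b ℤ.* c)
      regroup = solve-∀

  2u·φ1²≤Σφ² : + 2 ℤ.* + u ℤ.* (φ 1# ℤ.* φ 1#) ℤ.≤ Σ (λ a → φ a ℤ.* φ a)
  2u·φ1²≤Σφ² = ℤₚ.≤-trans (ℤₚ.≤-reflexive count) (Σ-mono-≤ {λ a → 𝟙QR a ℤ.* (φ 1# ℤ.* φ 1#)} {λ a → φ a ℤ.* φ a} pointwise)
    where
    open ≡.≡-Reasoning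
    count : + 2 ℤ.* + u ℤ.* (φ 1# ℤ.* φ 1#) ≡ Σ (λ a → 𝟙QR a ℤ.* (φ 1# ℤ.* φ 1#))
    count = begin
      + 2 ℤ.* + u ℤ.* (φ 1# ℤ.* φ 1#)
        ≡⟨ ≡.cong (ℤ._* (φ 1# ℤ.* φ 1#)) (≡.trans (≡.sym (ℤₚ.pos-* 2 u)) (≡.sym Σ𝟙QR≡m)) ⟩
      Σ 𝟙QR ℤ.* (φ 1# ℤ.* φ 1#)
        ≡⟨ ℤₚ.*-comm (Σ 𝟙QR) _ ⟩
      (φ 1# ℤ.* φ 1#) ℤ.* Σ 𝟙QR
        ≡⟨ Σ-*ˡ (φ 1# ℤ.* φ 1#) 𝟙QR ⟨
      Σ (λ a → (φ 1# ℤ.* φ 1#) ℤ.* 𝟙QR a)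
        ≡⟨ Σ-cong (λ a → ℤₚ.*-comm (φ 1# ℤ.* φ 1#) (𝟙QR a)) ⟩
      Σ (λ a → 𝟙QR a ℤ.* (φ 1# ℤ.* φ 1#)) ∎
    pointwise : ∀ a → 𝟙QR a ℤ.* (φ 1# ℤ.* φ 1#) ℤ.≤ φ a ℤ.* φ a
    pointwise a with QR? a
    ... | no _ = square-nonneg (φ a)
    ... | yes (a≉0 , t , tt≈a) = ℤₚ.≤-reflexive (begin
      1ℤ ℤ.* (φ 1# ℤ.* φ 1#)
        ≡⟨ ≡.cong (ℤ._* (φ 1# ℤ.* φ 1#)) (χ*χ≡1 t≉0) ⟨
      χ t ℤ.* χ t ℤ.* (φ 1# ℤ.* φ 1#)
        ≡⟨ swap (χ t) (φ 1#) ⟩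
      (χ t ℤ.* φ 1#) ℤ.* (χ t ℤ.* φ 1#)
        ≡⟨ ≡.cong (λ v → v ℤ.* v) (≡.trans (≡.sym (φ-square t≉0)) (φ-resp tt≈a)) ⟩
      φ a ℤ.* φ a ∎)
      where
      t≉0 : ¬ (t ≈ 0#)
      t≉0 t≈0 = a≉0 (trans (sym tt≈a) (trans (*-congʳ t≈0) (zeroˡ t)))
      swap : ∀ c f → c ℤ.* c ℤ.* (f ℤ.* f) ≡ (c ℤ.* f) ℤ.* (c ℤ.* f)
      swap = solve-∀

  NQRWithQRNeighbours : Carrier → Set (c ⊔ ℓ)
  NQRWithQRNeighbours β = NQR F β × QR F (β + 1#) × QR F (β - 1#)

  χ-⁻¹+1 : ∀ {x} → ¬ (x ≈ 0#) → χ (x ⁻¹ + 1#) ≡ χ (x + 1#) ℤ.* χ x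
  χ-⁻¹+1 {x} x≉0 = ≡.trans (χ-cong factor) (≡.trans (χ-* (x + 1#) (x ⁻¹)) (≡.cong (χ (x + 1#) ℤ.*_) (χ-⁻¹ x)))
    where
    factor : x ⁻¹ + 1# ≈ (x + 1#) * x ⁻¹
    factor = sym (trans (solve 2 (λ x i → (x :+ con (+ 1)) :* i := x :* i :+ i) refl x (x ⁻¹))
                        (trans (+-congʳ (⁻¹-inverseʳ x≉0)) (+-comm 1# (x ⁻¹))))

  χ-⁻¹-1 : ∀ {x} → ¬ (x ≈ 0#) → χ (x ⁻¹ - 1#) ≡ χ (x - 1#) ℤ.* χ x
  χ-⁻¹-1 {x} x≉0 = begin
    χ (x ⁻¹ - 1#)                     ≡⟨ χ-cong factor ⟩
    χ (- ((x - 1#) * x ⁻¹))           ≡⟨ χ-neg _ ⟩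
    χ ((x - 1#) * x ⁻¹)               ≡⟨ χ-* (x - 1#) (x ⁻¹) ⟩
    χ (x - 1#) ℤ.* χ (x ⁻¹)           ≡⟨ ≡.cong (χ (x - 1#) ℤ.*_) (χ-⁻¹ x) ⟩
    χ (x - 1#) ℤ.* χ x                ∎
    where
    open ≡.≡-Reasoning
    factor : x ⁻¹ - 1# ≈ - ((x - 1#) * x ⁻¹)
    factor = sym (trans (solve 2 (λ x i → :- ((x :- con (+ 1)) :* i) := i :- x :* i) refl x (x ⁻¹))
                        (+-congˡ (-‿cong (⁻¹-inverseʳ x≉0))))

  -- Witnesses come in pairs β ↔ β⁻¹, so a nonsquare y with χ(y - 1) = χ(y + 1) = -1 also yields one.
  no-witness⇒QR : (∀ β → ¬ NQRWithQRNeighbours β) → ∀ {y} → ¬ (y ≈ 0#) → QR F (y * y - 1#) → QR F y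
  no-witness⇒QR none {y} y≉0 qyy-1 with classify y
  ... | isZero y≈0 = ⊥-elim (y≉0 y≈0)
  ... | isQR qy    = qy
  ... | isNQR ny   = ⊥-elim (neighbours (classify (y - 1#)) (classify (y + 1#)) χ-product)
    where
    χ-product : χ (y - 1#) ℤ.* χ (y + 1#) ≡ 1ℤ
    χ-product = ≡.trans (≡.sym (χ-* (y - 1#) (y + 1#)))
                        (≡.trans (χ-cong (solve 1 (λ y → (y :- con (+ 1)) :* (y :+ con (+ 1)) := y :* y :- con (+ 1)) refl y))
                                 (χ-QR qyy-1))
    neighbours : (k : SquareClass (y - 1#)) (l : SquareClass (y + 1#)) → classValue k ℤ.* classValue l ≡ 1ℤ → ⊥
    neighbours (isQR q-) (isQR q+) _ = none y (ny , q+ , q-)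
    neighbours (isNQR n-) (isNQR n+) _ =
      none (y ⁻¹) ( χ≡-1⇒NQR (≡.trans (χ-⁻¹ y) (χ-NQR ny))
                  , χ≡1⇒QR (≡.trans (χ-⁻¹+1 y≉0) (≡.cong₂ ℤ._*_ (χ-NQR n+) (χ-NQR ny)))
                  , χ≡1⇒QR (≡.trans (χ-⁻¹-1 y≉0) (≡.cong₂ ℤ._*_ (χ-NQR n-) (χ-NQR ny))))
    neighbours (isZero _) (isZero _) ()
    neighbours (isZero _) (isQR _)   ()
    neighbours (isZero _) (isNQR _)  ()
    neighbours (isQR _)   (isZero _) ()
    neighbours (isQR _)   (isNQR _)  ()
    neighbours (isNQR _)  (isZero _) ()
    neighbours (isNQR _)  (isQR _)   ()

  private
    cancel-sign : ∀ a b c → c ℤ.* c ≡ 1ℤ → b ℤ.* (c ℤ.* a) ≡ 1ℤ → a ℤ.* b ≡ c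
    cancel-sign a b c c²≡1 bca≡1 = begin
      a ℤ.* b                        ≡⟨ ℤₚ.*-identityˡ (a ℤ.* b) ⟨
      1ℤ ℤ.* (a ℤ.* b)               ≡⟨ ≡.cong (ℤ._* (a ℤ.* b)) c²≡1 ⟨
      (c ℤ.* c) ℤ.* (a ℤ.* b)        ≡⟨ regroup a b c ⟩
      c ℤ.* (b ℤ.* (c ℤ.* a))        ≡⟨ ≡.cong (c ℤ.*_) bca≡1 ⟩
      c ℤ.* 1ℤ                       ≡⟨ ℤₚ.*-identityʳ c ⟩
      c                              ∎
      where
      open ≡.≡-Reasoning
      regroup : ∀ a b c → (c ℤ.* c) ℤ.* (a ℤ.* b) ≡ c ℤ.* (b ℤ.* (c ℤ.* a))
      regroup = solve-∀

  no-witness⇒χ[x]χ[x²+1]≡χ2 : (∀ β → ¬ NQRWithQRNeighbours β) → ∀ {x} → ¬ (x ≈ 0#) → ¬ (x * x + 1# ≈ 0#) →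
                              χ x ℤ.* χ (x * x + 1#) ≡ χ 2#
  no-witness⇒χ[x]χ[x²+1]≡χ2 none {x} x≉0 x²+1≉0 = by-cases (x * x ≈? 1#)
    where
    by-cases : Dec (x * x ≈ 1#) → χ x ℤ.* χ (x * x + 1#) ≡ χ 2#
    by-cases (yes xx≈1) = ≡.trans (≡.cong₂ ℤ._*_ (χx≡1 (x*x≈y*y⇒ (trans (*-identityˡ 1#) (sym xx≈1)))) (χ-cong (+-congʳ xx≈1)))
                                  (ℤₚ.*-identityˡ _)
      where
      χx≡1 : x ≈ 1# ⊎ x ≈ - 1# → χ x ≡ 1ℤ
      χx≡1 (inj₁ x≈1)  = χ-QR (QR-cong (sym x≈1) QR-1)
      χx≡1 (inj₂ x≈-1) = χ-QR (QR-cong (sym x≈-1) QR-−1)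
    by-cases (no xx≉1) = cancel-sign (χ x) (χ (x * x + 1#)) (χ 2#) (χ*χ≡1 2≉0) χy≡χ[x²+1]χ2χx
      where
      2x≉0 : ¬ (2# * x ≈ 0#)
      2x≉0 = *-≉0 2≉0 x≉0
      w y r : Carrier
      w = (2# * x) ⁻¹
      y = (x * x + 1#) * w
      r = (x * x - 1#) * w
      r≉0 : ¬ (r ≈ 0#)
      r≉0 = *-≉0 (λ xx-1≈0 → xx≉1 (trans (solve 1 (λ x → x :* x := (x :* x :- con (+ 1)) :+ con (+ 1)) refl x)
                                          (trans (+-congʳ xx-1≈0) (+-identityˡ 1#))))
                 (⁻¹-≉0 2x≉0)
      yy-1≈rr : y * y - 1# ≈ r * r
      yy-1≈rr = begin
        y * y - 1#
          ≈⟨ solve 2 (λ x w → ((x :* x :+ con (+ 1)) :* w) :* ((x :* x :+ con (+ 1)) :* w) :- con (+ 1)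
                         := ((x :* x :- con (+ 1)) :* w) :* ((x :* x :- con (+ 1)) :* w)
                            :+ (((con (+ 1) :+ con (+ 1)) :* x :* w) :* ((con (+ 1) :+ con (+ 1)) :* x :* w)
                                :- con (+ 1)))
                     refl x w ⟩
        r * r + ((2# * x * w) * (2# * x * w) - 1#)
          ≈⟨ +-congˡ (+-congʳ (*-cong (⁻¹-inverseʳ 2x≉0) (⁻¹-inverseʳ 2x≉0))) ⟩
        r * r + (1# * 1# - 1#)
          ≈⟨ solve 1 (λ s → s :+ (con (+ 1) :* con (+ 1) :- con (+ 1)) := s) refl (r * r) ⟩
        r * r ∎
        where open ≈-Reasoning
      qy : QR F y
      qy = no-witness⇒QR none (*-≉0 x²+1≉0 (⁻¹-≉0 2x≉0)) (QR-cong (sym yy-1≈rr) (*-≉0 r≉0 r≉0 , r , refl))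
      χy≡χ[x²+1]χ2χx : χ (x * x + 1#) ℤ.* (χ 2# ℤ.* χ x) ≡ 1ℤ
      χy≡χ[x²+1]χ2χx = ≡.trans (≡.cong (χ (x * x + 1#) ℤ.*_) (≡.sym (≡.trans (χ-⁻¹ (2# * x)) (χ-* 2# x))))
                               (≡.trans (≡.sym (χ-* (x * x + 1#) w)) (χ-QR qy))

  no-witness⇒φ1 : (∀ β → ¬ NQRWithQRNeighbours β) → φ 1# ≡ χ 2# ℤ.* (+ q ℤ.- + 3)
  no-witness⇒φ1 none = begin
    φ 1#
      ≡⟨ Σ-cong pointwise ⟩
    Σ (λ x → χ 2# ℤ.* (1ℤ ℤ.- δ 0# x ℤ.- δ (- 1#) (x * x)))
      ≡⟨ Σ-*ˡ (χ 2#) (λ x → 1ℤ ℤ.- δ 0# x ℤ.- δ (- 1#) (x * x)) ⟩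
    χ 2# ℤ.* Σ (λ x → 1ℤ ℤ.- δ 0# x ℤ.- δ (- 1#) (x * x))
      ≡⟨ ≡.cong (χ 2# ℤ.*_) count ⟩
    χ 2# ℤ.* (+ q ℤ.- + 3) ∎
    where
    open ≡.≡-Reasoning
    pointwise : ∀ x → χ x ℤ.* χ (x * x + 1#) ≡ χ 2# ℤ.* (1ℤ ℤ.- δ 0# x ℤ.- δ (- 1#) (x * x))
    pointwise x with x ≈? 0# | x * x ≈? - 1#
    ... | yes x≈0 | yes xx≈-1 = ⊥-elim (-1≉0 (trans (sym xx≈-1) (trans (*-congʳ x≈0) (zeroˡ x))))
    ... | yes x≈0 | no _      = ≡.trans (≡.cong (ℤ._* χ (x * x + 1#)) (χ-≈0 x≈0)) (≡.sym (ℤₚ.*-zeroʳ (χ 2#)))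
    ... | no _    | yes xx≈-1 = ≡.trans (≡.cong (χ x ℤ.*_) (χ-≈0 (trans (+-congʳ xx≈-1) (-‿inverseˡ 1#))))
                                        (≡.trans (ℤₚ.*-zeroʳ (χ x)) (≡.sym (ℤₚ.*-zeroʳ (χ 2#))))
    ... | no x≉0  | no xx≉-1  = ≡.trans (no-witness⇒χ[x]χ[x²+1]≡χ2 none x≉0 xx+1≉0) (≡.sym (ℤₚ.*-identityʳ (χ 2#)))
      where
      xx+1≉0 : ¬ (x * x + 1# ≈ 0#)
      xx+1≉0 xx+1≈0 = xx≉-1 (trans (solve 1 (λ x → x :* x := (x :* x :+ con (+ 1)) :- con (+ 1)) refl x)
                                   (trans (+-congʳ xx+1≈0) (+-identityˡ (- 1#))))
    count : Σ (λ x → 1ℤ ℤ.- δ 0# x ℤ.- δ (- 1#) (x * x)) ≡ + q ℤ.- + 3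
    count = begin
      Σ (λ x → 1ℤ ℤ.- δ 0# x ℤ.- δ (- 1#) (x * x))
        ≡⟨ Σ-+ (λ x → 1ℤ ℤ.- δ 0# x) (λ x → ℤ.- δ (- 1#) (x * x)) ⟩
      Σ (λ x → 1ℤ ℤ.- δ 0# x) ℤ.+ Σ (λ x → ℤ.- δ (- 1#) (x * x))
        ≡⟨ ≡.cong₂ ℤ._+_ (Σ1-δ 0#) (≡.trans (Σ-neg (λ x → δ (- 1#) (x * x))) (≡.cong ℤ.-_ #square-roots[−1])) ⟩
      + q ℤ.- 1ℤ ℤ.- (1ℤ ℤ.+ 1ℤ)
        ≡⟨ simplify (+ q) ⟩
      + q ℤ.- + 3 ∎
      where
      #square-roots[−1] : Σ (λ x → δ (- 1#) (x * x)) ≡ 1ℤ ℤ.+ 1ℤ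
      #square-roots[−1] = ≡.trans (#square-roots (- 1#)) (≡.cong (λ v → 1ℤ ℤ.+ v) (χ-QR QR-−1))
      simplify : ∀ n → n ℤ.- 1ℤ ℤ.- (1ℤ ℤ.+ 1ℤ) ≡ n ℤ.- + 3
      simplify = solve-∀

  NQRWithQRNeighbours? : ∀ β → Dec (NQRWithQRNeighbours β)
  NQRWithQRNeighbours? β = NQR? β ×-dec QR? (β + 1#) ×-dec QR? (β - 1#)

  NQRWithQRNeighbours-cong : ∀ {β γ} → β ≈ γ → NQRWithQRNeighbours β → NQRWithQRNeighbours γ
  NQRWithQRNeighbours-cong β≈γ (nβ , qβ+1 , qβ-1) = NQR-cong β≈γ nβ , QR-cong (+-congʳ β≈γ) qβ+1 , QR-cong (+-congʳ β≈γ) qβ-1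

  ∃NQRWithQRNeighbours : 3 ℕ.≤ u → ∃ NQRWithQRNeighbours
  ∃NQRWithQRNeighbours 3≤u with ∃? NQRWithQRNeighbours? NQRWithQRNeighbours-cong
  ... | yes witness = witness
  ... | no ¬witness = ⊥-elim (ℤₚ.<⇒≱ (2q[q-1]<2n[q-3]² 3≤u) (≡.subst₂ ℤ._≤_ 2u·φ1²≡ Σφ²≡ 2u·φ1²≤Σφ²))
    where
    open ≡.≡-Reasoning
    Q : ℤ
    Q = 1ℤ ℤ.+ + 4 ℤ.* + u
    q≡Q : + q ≡ Q
    q≡Q = ≡.trans (≡.cong +_ q≡1+4u) (≡.trans (ℤₚ.pos-+ 1 (4 ℕ.* u)) (≡.cong (λ n → 1ℤ ℤ.+ n) (ℤₚ.pos-* 4 u)))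
    φ1*φ1≡ : φ 1# ℤ.* φ 1# ≡ (Q ℤ.- + 3) ℤ.* (Q ℤ.- + 3)
    φ1*φ1≡ = begin
      φ 1# ℤ.* φ 1#
        ≡⟨ ≡.cong (λ n → n ℤ.* n) (no-witness⇒φ1 (λ β w → ¬witness (β , w))) ⟩
      χ 2# ℤ.* (+ q ℤ.- + 3) ℤ.* (χ 2# ℤ.* (+ q ℤ.- + 3))
        ≡⟨ interchange (χ 2#) (+ q ℤ.- + 3) ⟩
      χ 2# ℤ.* χ 2# ℤ.* ((+ q ℤ.- + 3) ℤ.* (+ q ℤ.- + 3))
        ≡⟨ ≡.cong₂ (λ s n → s ℤ.* ((n ℤ.- + 3) ℤ.* (n ℤ.- + 3))) (χ*χ≡1 2≉0) q≡Q ⟩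
      1ℤ ℤ.* ((Q ℤ.- + 3) ℤ.* (Q ℤ.- + 3))
        ≡⟨ ℤₚ.*-identityˡ _ ⟩
      (Q ℤ.- + 3) ℤ.* (Q ℤ.- + 3) ∎
      where
      interchange : ∀ a b → a ℤ.* b ℤ.* (a ℤ.* b) ≡ a ℤ.* a ℤ.* (b ℤ.* b)
      interchange = solve-∀
    2u·φ1²≡ : + 2 ℤ.* + u ℤ.* (φ 1# ℤ.* φ 1#) ≡ + 2 ℤ.* + u ℤ.* ((Q ℤ.- + 3) ℤ.* (Q ℤ.- + 3))
    2u·φ1²≡ = ≡.cong (+ 2 ℤ.* + u ℤ.*_) φ1*φ1≡
    Σφ²≡ : Σ (λ a → φ a ℤ.* φ a) ≡ + 2 ℤ.* Q ℤ.* (Q ℤ.- 1ℤ)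
    Σφ²≡ = ≡.trans Σφ*φ (≡.cong (λ n → + 2 ℤ.* n ℤ.* (n ℤ.- 1ℤ)) q≡Q)

  nonsquare-pair : 3 ℕ.≤ u → ∃₂ λ β₁ β₂ → NQR F β₁ × NQR F β₂ × NQR F (β₁ + 1#) × QR F (β₂ + 1#)
                                                   × NQR F (β₁ - 1#) × QR F (β₂ - 1#)
  nonsquare-pair 3≤u with ∃NQRWithQRNeighbours 3≤u
  ... | β , nβ , qβ+1 , qβ-1 =
    β ⁻¹ , β , χ≡-1⇒NQR (≡.trans (χ-⁻¹ β) (χ-NQR nβ)) , nβ
        , χ≡-1⇒NQR (≡.trans (χ-⁻¹+1 (proj₁ nβ)) (≡.cong₂ ℤ._*_ (χ-QR qβ+1) (χ-NQR nβ))) , qβ+1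
        , χ≡-1⇒NQR (≡.trans (χ-⁻¹-1 (proj₁ nβ)) (≡.cong₂ ℤ._*_ (χ-QR qβ-1) (χ-NQR nβ))) , qβ-1

open import Data.Nat using (_+_; _*_; _^_; _<_; _≤_; s≤s; z≤n)
import Data.Nat.Properties as ℕₚ
open import Data.Nat.Divisibility using (_∣_; divides)
open import Data.Nat.Tactic.RingSolver using (solve-∀)
open import Data.Product using (∃₂; _×_)
open import Relation.Binary.PropositionalEquality using (refl; trans)
open import Relation.Nullary using (¬_)
open import Relation.Nullary.Negation using (contradiction)

odd>1⇒≥3 : ∀ {t} → 1 < t → ¬ (2 ∣ t) → 3 ≤ t
odd>1⇒≥3 {1}                 (s≤s ()) _
odd>1⇒≥3 {2}                 _        2∤2 = contradiction (divides 1 refl) 2∤2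
odd>1⇒≥3 {suc (suc (suc _))} _        _   = s≤s (s≤s (s≤s z≤n))

mainTheorem3 : ∀ {c ℓ} (F : CommutativeRing c ℓ) (q k t : ℕ) → IsFiniteField F q → q ≡ 2 ^ k * t + 1 →
               1 < k → 1 < t → ¬ (2 ∣ t) →
               ∃₂ λ β₁ β₂ → NQR F β₁ × NQR F β₂
                          × NQR F (CommutativeRing._+_ F β₁ (CommutativeRing.1# F))
                          × QR F (CommutativeRing._+_ F β₂ (CommutativeRing.1# F))
                          × NQR F (CommutativeRing._-_ F β₁ (CommutativeRing.1# F))
                          × QR F (CommutativeRing._-_ F β₂ (CommutativeRing.1# F))
mainTheorem3 F q 1 t isFF _ (s≤s ()) _ _
mainTheorem3 F q (suc (suc k)) t isFF q≡2^kt+1 _ 1<t 2∤t = nonsquare-pair 3≤u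
  where
  u : ℕ
  u = 2 ^ k * t
  q≡1+4u : q ≡ suc (4 * u)
  q≡1+4u = trans q≡2^kt+1 (regroup (2 ^ k) t)
    where
    regroup : ∀ p t → 2 * (2 * p) * t + 1 ≡ suc (4 * (p * t))
    regroup = solve-∀
  3≤u : 3 ≤ u
  3≤u = ℕₚ.≤-trans (odd>1⇒≥3 1<t 2∤t) (ℕₚ.m≤n*m t (2 ^ k) {{ℕₚ.m^n≢0 2 k}})
  open OneModFour F isFF {u} q≡1+4u
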